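{- Let $\mathscr C^*$ be an optimal rooted cycle cover with optimal value $\lambda^*$, let $F_{\rm opt}$ be a forest produced by the bad-tree elimination procedure described in the context, let $n_{LT}$ be the number of light trees in $F_{\rm opt}$, and let $F_h$ be the collection of heavy trees in $F_{\rm opt}$. Then $w(F_h)\le (k-n_{LT})\lambda^*$.
   Context: Setting: $G=(V,E)$ is a complete undirected graph and $w:E\to[0,\infty)$ is a metric (symmetric, triangle inequality). $D\subseteq V$ is the set of depots, $m=|D|$, $V^-=V\setminus D$, and $k\ge m$ is an integer. For a subgraph $H$, $\mathcal V(H)$ and $\mathcal E(H)$ are its vertex and edge sets and $w(H)$ is the total edge weight (for a collection of trees, the total over all trees). A rooted cycle cover with at most $k$ cycles is a collection $\{C_1,\dots,C_q\}$ of cycles in $G$ with $q\le k$, pairwise edge-disjoint, each containing exactly one vertex of $D$, and with $\bigcup_j\mathcal V(C_j)=V$. $\lambda^*$ is the minimum over such covers of $\max_j w(C_j)$, and $\mathscr C^*$ is a fixed cover attaining it. Forest $F^*$: merge all depots into a new vertex $\hat d$ with $w(\hat d,v)=\min_{d\in D}w(d,v)$ for $v\in V^-$; compute a minimum spanning tree of the complete graph on $V^-\cup\{\hat d\}$; replace each edge $(v,\hat d)$ by $(d^\star,v)$ with $d^\star\in\arg\min_{d\in D}w(d,v)$ (ties arbitrary), add the depots and delete $\hat d$. $F^*$ is a spanning forest with $m$ trees, each containing one depot. Edge set $E^\dagger$: starting from $F^*$, repeatedly choose a minimum-weight edge of $E$ joining two distinct trees of the current forest, add it to $E^\dagger$ and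 merge those trees, until one tree remains. Tree types (relative to $\lambda^*$ and $\mathscr C^*$): a tree $T$ is heavy if $w(T)\ge\lambda^*$; light if $w(T)<\lambda^*$ and $\mathcal V(C)\subseteq\mathcal V(T)$ for some $C\in\mathscr C^*$; bad if $w(T)<\lambda^*$ and there is no $C\in\mathscr C^*$ with $\mathcal V(C)\subseteq\mathcal V(T)$. Bad-tree elimination: start with $F_{\rm tmp}=F^*$; while $F_{\rm tmp}$ contains a bad tree, choose any bad tree $T_b$, pick a minimum-weight edge $(v,v')\in E^\dagger$ with $v\in\mathcal V(T_b)$, $v'\notin\mathcal V(T_b)$, and replace $T_b$ and the tree $T_c$ of $F_{\rm tmp}$ containing $v'$ by the tree obtained by joining them with this edge. $F_{\rm opt}$ is the final $F_{\rm tmp}$.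
   Formalization: The edge weights $w$ are rational instead of real, so the optimal value $\lambda^*$ is also taken in ℚ. -}

module Defs where

open import Data.Nat as ℕ using (ℕ; suc)
open import Data.Integer as ℤ using (ℤ; +_)
open import Data.Fin as Fin using (Fin)
open import Data.Fin.Subset as Sub using (Subset; ∣_∣)
open import Data.Fin.Subset.Properties as SubP using ()
open import Data.Maybe using (Maybe; just; nothing)
open import Data.Rational as ℚ using (ℚ; 0ℚ; _≤_; _<_; _+_; _*_; _-_; _/_)
open import Data.Rational.Properties as ℚP using (_≤?_; _<?_)
open import Data.List as List using (List; []; _∷_; _++_; length; filter; concatMap; allFin; lookup)
open import Data.List.Relation.Unary.All as All using (All; all?)
open import Data.List.Relation.Unary.Any as Any using (Any; any?)
open import Data.List.Relation.Unary.Unique.Propositional using (Unique)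
open import Data.List.Membership.Propositional using (_∈_; _∉_)
import Data.List.Membership.DecPropositional as DecMem
open import Data.List.Relation.Binary.Permutation.Propositional using (_↭_)
open import Data.Product using (_×_; _,_; ∃; ∃-syntax; proj₁; proj₂)
open import Data.Sum using (_⊎_)
open import Relation.Nullary using (¬_; Dec; ¬?)
open import Relation.Nullary.Decidable using (_×-dec_)
open import Relation.Binary.PropositionalEquality using (_≡_; _≢_)

-- Generic graph notions on a vertex type A; edges are ordered pairs,
-- read as undirected edges.

module _ {A : Set} where

  consec : List A → List (A × A)
  consec (x ∷ y ∷ r) = (x , y) ∷ consec (y ∷ r)
  consec _ = []

  lastOf : A → List A → A
  lastOf x [] = x
  lastOf x (y ∷ r) = lastOf y r

  -- edges of the cycle v0 v1 ... v_{r-1} v0 (no edge when r ≤ 1;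
  -- for r = 2 the edge {v0,v1} is traversed twice)
  cycleEdges : List A → List (A × A)
  cycleEdges [] = []
  cycleEdges (x ∷ []) = []
  cycleEdges (x ∷ y ∷ r) = consec (x ∷ y ∷ r) ++ ((lastOf y r , x) ∷ [])

  UEdge : List (A × A) → A → A → Set
  UEdge es a b = ((a , b) ∈ es) ⊎ ((b , a) ∈ es)

  data Conn (es : List (A × A)) : A → A → Set where
    here : ∀ {a} → Conn es a a
    step : ∀ {a b c} → UEdge es a b → Conn es b c → Conn es a c

  HasCycle : List (A × A) → Set
  HasCycle es = ∃[ c ] (Unique c × (3 ℕ.≤ length c)
                        × All (λ e → UEdge es (proj₁ e) (proj₂ e)) (cycleEdges c))

  SpanningTree : List A → List (A × A) → Set
  SpanningTree vs es =
      All (λ e → (proj₁ e ≢ proj₂ e) × (proj₁ e ∈ vs) × (proj₂ e ∈ vs)) es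
    × Unique es
    × (∀ {a b} → (a , b) ∈ es → (b , a) ∉ es)
    × (∀ {a b} → a ∈ vs → b ∈ vs → Conn es a b)
    × ¬ HasCycle es

  wsum : (A → A → ℚ) → List (A × A) → ℚ
  wsum w [] = 0ℚ
  wsum w ((a , b) ∷ es) = w a b + wsum w es

  MST : (A → A → ℚ) → List A → List (A × A) → Set
  MST w vs es = SpanningTree vs es
              × (∀ es' → SpanningTree vs es' → wsum w es ≤ wsum w es')

module _ {n : ℕ} where

  Edge : Set
  Edge = Fin n × Fin n

  IsMetric : (Fin n → Fin n → ℚ) → Set
  IsMetric w = (∀ u → w u u ≡ 0ℚ)
             × (∀ u v → 0ℚ ≤ w u v)
             × (∀ u v → w u v ≡ w v u)
             × (∀ u v z → w u z ≤ w u v + w v z)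

  -- a cycle is given by its list of distinct vertices v0 ... v_{r-1}, r ≥ 1
  cycleW : (Fin n → Fin n → ℚ) → List (Fin n) → ℚ
  cycleW w c = wsum w (cycleEdges c)

  depotsIn : Subset n → List (Fin n) → List (Fin n)
  depotsIn D c = filter (λ v → v SubP.∈? D) c

  EdgeDisjoint : List (Fin n) → List (Fin n) → Set
  EdgeDisjoint c c' = ∀ {a b} → (a , b) ∈ cycleEdges c → ¬ UEdge (cycleEdges c') a b

  IsRootedCover : Subset n → ℕ → List (List (Fin n)) → Set
  IsRootedCover D k Cs =
      (length Cs ℕ.≤ k)
    × All (λ c → (1 ℕ.≤ length c) × Unique c × (length (depotsIn D c) ≡ 1)) Cs
    × (∀ i j → i ≢ j → EdgeDisjoint (lookup Cs i) (lookup Cs j))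
    × (∀ v → Any (v ∈_) Cs)

  IsOptimalCover : Subset n → ℕ → (Fin n → Fin n → ℚ) → List (List (Fin n)) → ℚ → Set
  IsOptimalCover D k w Cs λ* =
      IsRootedCover D k Cs
    × All (λ c → cycleW w c ≤ λ*) Cs
    × Any (λ c → cycleW w c ≡ λ*) Cs
    × (∀ Cs' μ → IsRootedCover D k Cs' → All (λ c → cycleW w c ≤ μ) Cs' → λ* ≤ μ)

  -- contracted graph: nothing = merged depot d̂, just v = v ∈ V⁻
  contractedVerts : Subset n → List (Maybe (Fin n))
  contractedVerts D = nothing ∷ List.map just (filter (λ v → ¬? (v SubP.∈? D)) (allFin n))

  ŵ : (Fin n → Fin n → ℚ) → (Fin n → Fin n) → Maybe (Fin n) → Maybe (Fin n) → ℚ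
  ŵ w d⋆ (just u) (just v) = w u v
  ŵ w d⋆ nothing (just v) = w (d⋆ v) v
  ŵ w d⋆ (just v) nothing = w (d⋆ v) v
  ŵ w d⋆ nothing nothing = 0ℚ

  IsArgminChoice : Subset n → (Fin n → Fin n → ℚ) → (Fin n → Fin n) → Set
  IsArgminChoice D w d⋆ = ∀ v → (d⋆ v Sub.∈ D) × (∀ d → d Sub.∈ D → w (d⋆ v) v ≤ w d v)

  uncontract : (Fin n → Fin n) → Maybe (Fin n) × Maybe (Fin n) → List Edge
  uncontract d⋆ (just u , just v) = (u , v) ∷ []
  uncontract d⋆ (nothing , just v) = (d⋆ v , v) ∷ []
  uncontract d⋆ (just v , nothing) = (d⋆ v , v) ∷ []
  uncontract d⋆ (nothing , nothing) = []

  Fstar : (Fin n → Fin n) → List (Maybe (Fin n) × Maybe (Fin n)) → List Edge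
  Fstar d⋆ T̂ = concatMap (uncontract d⋆) T̂

  Tree : Set
  Tree = List (Fin n) × List Edge

  verts : Tree → List (Fin n)
  verts = proj₁

  tedges : Tree → List Edge
  tedges = proj₂

  treeW : (Fin n → Fin n → ℚ) → Tree → ℚ
  treeW w T = wsum w (tedges T)

  IsTreesOf : List Edge → List Tree → Set
  IsTreesOf F Ts =
      (concatMap verts Ts ↭ allFin n)
    × (concatMap tedges Ts ↭ F)
    × All (λ T → (1 ℕ.≤ length (verts T))
               × All (λ e → (proj₁ e ∈ verts T) × (proj₂ e ∈ verts T)) (tedges T)
               × (∀ {a b} → a ∈ verts T → b ∈ verts T → Conn (tedges T) a b)) Ts

  merge : Tree → Tree → Edge → Tree
  merge T T' e = (verts T ++ verts T' , e ∷ tedges T ++ tedges T')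

  SameTree : List Tree → Fin n → Fin n → Set
  SameTree Ts a b = Any (λ T → (a ∈ verts T) × (b ∈ verts T)) Ts

  -- E† : Dagger w Ts Es  says that Es is a possible output of the greedy
  -- merging procedure started from the forest with trees Ts
  data Dagger (w : Fin n → Fin n → ℚ) : List Tree → List Edge → Set where
    done : ∀ {T} → Dagger w (T ∷ []) []
    join : ∀ {Ts T₁ T₂ rest u v Es}
         → Ts ↭ (T₁ ∷ T₂ ∷ rest)
         → u ∈ verts T₁ → v ∈ verts T₂
         → (∀ a b → ¬ SameTree Ts a b → w u v ≤ w a b)
         → Dagger w (merge T₁ T₂ (u , v) ∷ rest) Es
         → Dagger w Ts ((u , v) ∷ Es)

  module Types (w : Fin n → Fin n → ℚ) (Cs : List (List (Fin n))) (λ* : ℚ) where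

    ContainsCycle : Tree → Set
    ContainsCycle T = Any (λ c → All (_∈ verts T) c) Cs

    Heavy : Tree → Set
    Heavy T = λ* ≤ treeW w T

    Light : Tree → Set
    Light T = (treeW w T < λ*) × ContainsCycle T

    Bad : Tree → Set
    Bad T = (treeW w T < λ*) × ¬ ContainsCycle T

    containsCycle? : ∀ T → Dec (ContainsCycle T)
    containsCycle? T = any? (λ c → all? (λ v → DecMem._∈?_ Fin._≟_ v (verts T)) c) Cs

    heavy? : ∀ T → Dec (Heavy T)
    heavy? T = λ* ≤? treeW w T

    light? : ∀ T → Dec (Light T)
    light? T = (treeW w T <? λ*) ×-dec containsCycle? T

    -- Elim E† Ts Ts' : Ts' is a possible result of bad-tree elimination
    -- started from the forest with trees Ts, using the edge set E†
    data Elim (E† : List Edge) : List Tree → List Tree → Set where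
      stop : ∀ {Ts} → All (λ T → ¬ Bad T) Ts → Elim E† Ts Ts
      join : ∀ {Ts Tb Tc rest rest' v v' Ts'}
           → Ts ↭ (Tb ∷ rest)
           → Bad Tb
           → UEdge E† v v' → v ∈ verts Tb → v' ∉ verts Tb
           → (∀ a b → UEdge E† a b → a ∈ verts Tb → b ∉ verts Tb → w v v' ≤ w a b)
           → rest ↭ (Tc ∷ rest') → v' ∈ verts Tc
           → Elim E† (merge Tb Tc (v , v') ∷ rest') Ts'
           → Elim E† Ts Ts'

    nLT : List Tree → ℕ
    nLT Ts = length (filter light? Ts)

    heavyW : List Tree → ℚ
    heavyW Ts = List.foldr (λ T acc → treeW w T + acc) 0ℚ (filter heavy? Ts)

scaleBy : ℕ → ℕ → ℚ → ℚ
scaleBy k j λ* = ((+ k ℤ.- + j) / 1) * λ*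

{-# OPTIONS --safe #-}
-- Every tree T arising during bad-tree elimination is a union of trees of F* and carries a
-- cycle C of C* rooted in it with w(T) + max(C) ≤ Φ(V(T)), where Φ(X) is the weight of the
-- trees of F* meeting X plus the heaviest edges of the cycles of C* rooted in X; Φ is
-- superadditive on disjoint unions. Merging a bad tree T_b preserves this: its cycle leaves
-- T_b, so by the cut property of E† the merging edge is no heavier than max(C). Heavy trees
-- are not light, so summing over the non-light trees of F_opt, with vertex set S, gives
-- w(F_h) ≤ Φ(S). Deleting the heaviest edge of each cycle meeting S and shortcutting the
-- resulting paths through S yields, with the edges of the contracted MST away from S,
-- another spanning tree of the contracted graph; minimality of the MST then bounds Φ(S) by
-- the total weight of the cycles meeting S, each at most λ*. Each light tree contains a
-- whole cycle of C*, disjoint from S and from the other light trees, so at most k − n_LT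
-- cycles meet S.
module Submission where

open import Defs
open import Data.Nat using (ℕ)
open import Data.Fin using (Fin)
open import Data.Fin.Subset using (Subset; ∣_∣)
open import Data.Maybe using (Maybe)
open import Data.Rational using (ℚ; _≤_)
open import Data.List using (List)
open import Data.Product using (_×_)

open import Data.Nat as ℕ using (zero; suc; z≤n; s≤s)
import Data.Nat.Properties as ℕ
import Data.Integer as ℤ
import Data.Integer.Properties as ℤ
open import Data.Nat.Coprimality using (1-coprimeTo) renaming (sym to coprime-sym)
import Data.Fin as Fin
import Data.Fin.Subset as Sub
import Data.Fin.Subset.Properties as Sub
open import Data.Maybe using (just; nothing)
import Data.Maybe.Properties as Maybe
open import Data.Rational using (0ℚ; 1ℚ; _+_; _*_; _/_; -_; _⊔_; mkℚ; nonNegative)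
import Data.Rational.Properties as ℚ
open import Data.Rational.Properties using (≤-refl; ≤-trans; ≤-reflexive; +-mono-≤; +-monoˡ-≤; +-monoʳ-≤)
open import Data.Rational.Solver using (module +-*-Solver)
open import Data.List using ([]; _∷_; _++_; [_]; _∷ʳ_; length; filter; concatMap; allFin; reverse; foldr)
import Data.List.Properties as List
open import Data.List.Relation.Unary.All as All using (All; []; _∷_)
open import Data.List.Relation.Unary.All.Properties
  using (¬All⇒Any¬; all-filter) renaming (filter⁺ to All-filter⁺; ++⁻ˡ to All-++⁻ˡ)
open import Data.List.Relation.Unary.Any as Any using (Any; here; there; any?)
import Data.List.Relation.Unary.Any.Properties as AnyP
open import Data.List.Relation.Unary.Unique.Propositional using (Unique; []; _∷_)
open import Data.List.Relation.Unary.Unique.Propositional.Properties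
  using (allFin⁺) renaming (filter⁺ to Unique-filter⁺)
open import Data.List.Membership.Propositional using (_∈_; _∉_; lose; find)
open import Data.List.Membership.Propositional.Properties
  using (∈-++⁺ˡ; ∈-++⁺ʳ; ∈-++⁻; ∈-∃++; ∈-allFin; ∈-filter⁺; ∈-filter⁻; ∈-map⁺; ∈-map⁻;
         ∈-concatMap⁺; ∈-concatMap⁻)
import Data.List.Membership.DecPropositional as DecMembership
open import Data.List.Relation.Binary.Subset.Propositional using () renaming (_⊆_ to _⊆ᴸ_)
open import Data.List.Relation.Binary.Permutation.Propositional
  using (_↭_; ↭-refl; ↭-sym; ↭-trans; ↭-prep; ↭-reflexive; ↭⇒↭ₛ; module PermutationReasoning)
open import Data.List.Relation.Binary.Permutation.Propositional.Properties
  using (All-resp-↭; Any-resp-↭; ∈-resp-↭; ↭-length; ↭-reverse; filter-↭; ++⁺ˡ; ++-comm; shifts; shift; ∷↭∷ʳ)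
import Data.List.Relation.Binary.Permutation.Setoid.Properties as ↭ₛ
open import Data.Product using (_,_; ∃-syntax; proj₁; proj₂; uncurry)
open import Data.Sum using (_⊎_; inj₁; inj₂) renaming ([_,_] to either)
open import Data.Empty using (⊥; ⊥-elim)
open import Data.Unit using (⊤; tt)
open import Function using (_∘_)
open import Level using (0ℓ)
open import Relation.Nullary using (¬_; Dec; yes; no; ¬?; decidable-stable)
open import Relation.Nullary.Decidable using (_×-dec_; _⊎-dec_)
open import Relation.Unary using (Pred; Decidable; _⊆_)
open import Relation.Unary.Properties using (∁?)
open import Relation.Binary.Definitions using (DecidableEquality)
open import Relation.Binary.PropositionalEquality as Eq using (_≡_; _≢_; refl; sym; cong; cong₂; setoid)

open +-*-Solver using (solve; _:+_; _:*_; :-_; _:=_; con)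

p≤p+q : ∀ {p q} → 0ℚ ≤ q → p ≤ p + q
p≤p+q {p} {q} 0≤q = ≤-trans (≤-reflexive (sym (ℚ.+-identityʳ p))) (+-monoʳ-≤ p 0≤q)

p≤q+p : ∀ {p q} → 0ℚ ≤ q → p ≤ q + p
p≤q+p {p} {q} 0≤q = ≤-trans (≤-reflexive (sym (ℚ.+-identityˡ p))) (+-monoˡ-≤ p 0≤q)

+-nonNeg : ∀ {p q} → 0ℚ ≤ p → 0ℚ ≤ q → 0ℚ ≤ p + q
+-nonNeg 0≤p 0≤q = ≤-trans 0≤p (p≤p+q 0≤q)

+-cancelˡ-≤ : ∀ r {p q} → r + p ≤ r + q → p ≤ q
+-cancelˡ-≤ r {p} {q} r+p≤r+q = begin
  p               ≡⟨ solve 2 (λ r p → p := (:- r :+ r) :+ p) refl r p ⟩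
  - r + r + p     ≡⟨ ℚ.+-assoc (- r) r p ⟩
  - r + (r + p)   ≤⟨ +-monoʳ-≤ (- r) r+p≤r+q ⟩
  - r + (r + q)   ≡⟨ solve 2 (λ r q → :- r :+ (r :+ q) := q) refl r q ⟩
  q               ∎
  where open ℚ.≤-Reasoning

fromℕ-suc : ∀ m → ℤ.+ suc m / 1 ≡ 1ℚ + ℤ.+ m / 1
fromℕ-suc m = begin
  ℤ.+ suc m / 1                      ≡⟨ cong (λ i → (ℤ.+ 1 ℤ.+ i) / 1) (sym (ℤ.*-identityʳ (ℤ.+ m))) ⟩
  (ℤ.+ 1 ℤ.+ ℤ.+ m ℤ.* ℤ.+ 1) / 1   ≡⟨⟩  -- the sum of the normal forms 1/1 and m/1 unfolds to this
  1ℚ + m/1                           ≡⟨ cong (λ q → 1ℚ + q) (ℚ.↥p/↧p≡p m/1) ⟨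
  1ℚ + ℤ.+ m / 1                     ∎
  where
  open Eq.≡-Reasoning
  m/1 = mkℚ (ℤ.+ m) 0 (coprime-sym (1-coprimeTo m))

module _ {A : Set} where

  ∑ : (A → ℚ) → List A → ℚ
  ∑ f = foldr (λ x s → f x + s) 0ℚ

  ∑-++ : ∀ f xs ys → ∑ f (xs ++ ys) ≡ ∑ f xs + ∑ f ys
  ∑-++ f []       ys = sym (ℚ.+-identityˡ (∑ f ys))
  ∑-++ f (x ∷ xs) ys = Eq.trans (cong (f x +_) (∑-++ f xs ys)) (sym (ℚ.+-assoc (f x) _ _))

  ∑-↭ : ∀ f {xs ys} → xs ↭ ys → ∑ f xs ≡ ∑ f ys
  ∑-↭ f _↭_.refl              = refl
  ∑-↭ f (_↭_.prep x p)        = cong (f x +_) (∑-↭ f p)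
  ∑-↭ f (_↭_.swap {xs} x y p) = Eq.trans
    (solve 3 (λ a b s → a :+ (b :+ s) := b :+ (a :+ s)) refl (f x) (f y) (∑ f xs))
    (cong (λ s → f y + (f x + s)) (∑-↭ f p))
  ∑-↭ f (_↭_.trans p q)      = Eq.trans (∑-↭ f p) (∑-↭ f q)

  ∑-nonNeg : ∀ {f} → (∀ x → 0ℚ ≤ f x) → ∀ xs → 0ℚ ≤ ∑ f xs
  ∑-nonNeg f≥0 []       = ≤-refl
  ∑-nonNeg f≥0 (x ∷ xs) = +-nonNeg (f≥0 x) (∑-nonNeg f≥0 xs)

  ∑-mono-≤ : ∀ {f g xs} → All (λ x → f x ≤ g x) xs → ∑ f xs ≤ ∑ g xs
  ∑-mono-≤ []         = ≤-refl
  ∑-mono-≤ (px ∷ pxs) = +-mono-≤ px (∑-mono-≤ pxs)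

  ∑-partition : ∀ f {P : Pred A 0ℓ} (P? : Decidable P) xs →
                ∑ f xs ≡ ∑ f (filter P? xs) + ∑ f (filter (∁? P?) xs)
  ∑-partition f P? []       = sym (ℚ.+-identityʳ 0ℚ)
  ∑-partition f P? (x ∷ xs) with P? x
  ... | yes _ = Eq.trans (cong (f x +_) (∑-partition f P? xs)) (sym (ℚ.+-assoc (f x) _ _))
  ... | no  _ = Eq.trans (cong (f x +_) (∑-partition f P? xs))
    (solve 3 (λ a p q → a :+ (p :+ q) := p :+ (a :+ q))
      refl (f x) (∑ f (filter P? xs)) (∑ f (filter (∁? P?) xs)))

  ∑-filter-≤ : ∀ {f} → (∀ x → 0ℚ ≤ f x) → ∀ {P : Pred A 0ℓ} (P? : Decidable P) xs →
               ∑ f (filter P? xs) ≤ ∑ f xs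
  ∑-filter-≤ {f} f≥0 P? xs =
    ≤-trans (p≤p+q (∑-nonNeg f≥0 (filter (∁? P?) xs))) (≤-reflexive (sym (∑-partition f P? xs)))

  ∑≤m*bound : ∀ {f λ′} → 0ℚ ≤ λ′ → ∀ {xs} → All (λ x → f x ≤ λ′) xs →
          ∀ {m} → length xs ℕ.≤ m → ∑ f xs ≤ (ℤ.+ m / 1) * λ′
  ∑≤m*bound {λ′ = λ′} 0≤λ′ {[]} [] {m} _ = begin
    0ℚ                  ≡⟨ ℚ.*-zeroˡ λ′ ⟨
    0ℚ * λ′             ≤⟨ ℚ.*-monoʳ-≤-nonNeg λ′ {{nonNegative 0≤λ′}} (m/1≥0 m) ⟩
    (ℤ.+ m / 1) * λ′    ∎
    where
    open ℚ.≤-Reasoning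
    m/1≥0 : ∀ m → 0ℚ ≤ ℤ.+ m / 1
    m/1≥0 zero    = ≤-refl
    m/1≥0 (suc m) =
      ≤-trans (m/1≥0 m) (≤-trans (p≤q+p (ℚ.nonNegative⁻¹ 1ℚ)) (≤-reflexive (sym (fromℕ-suc m))))
  ∑≤m*bound {f} {λ′} 0≤λ′ {x ∷ xs} (fx≤λ′ ∷ pxs) {suc m} (s≤s len≤m) = begin
    f x + ∑ f xs               ≤⟨ +-mono-≤ fx≤λ′ (∑≤m*bound 0≤λ′ pxs len≤m) ⟩
    λ′ + (ℤ.+ m / 1) * λ′      ≡⟨ solve 2 (λ l q → l :+ q :* l := (con 1ℚ :+ q) :* l) refl λ′ (ℤ.+ m / 1) ⟩
    (1ℚ + ℤ.+ m / 1) * λ′      ≡⟨ cong (_* λ′) (fromℕ-suc m) ⟨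
    (ℤ.+ suc m / 1) * λ′       ∎
    where open ℚ.≤-Reasoning

  module _ {f : A → ℚ} (f≥0 : ∀ x → 0ℚ ≤ f x) where

    ∈⇒≤∑ : ∀ {x xs} → x ∈ xs → f x ≤ ∑ f xs
    ∈⇒≤∑ {xs = _ ∷ xs} (here refl) = p≤p+q (∑-nonNeg f≥0 xs)
    ∈⇒≤∑ {xs = y ∷ _}  (there x∈xs)   = ≤-trans (∈⇒≤∑ x∈xs) (p≤q+p (f≥0 y))

    ∑-filter-⊆ : ∀ {P Q : Pred A 0ℓ} (P? : Decidable P) (Q? : Decidable Q) → P ⊆ Q →
                 ∀ xs → ∑ f (filter P? xs) ≤ ∑ f (filter Q? xs)
    ∑-filter-⊆ P? Q? P⊆Q []       = ≤-refl
    ∑-filter-⊆ P? Q? P⊆Q (x ∷ xs) with P? x | Q? x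
    ... | yes _  | yes _  = +-monoʳ-≤ (f x) (∑-filter-⊆ P? Q? P⊆Q xs)
    ... | yes px | no ¬qx = ⊥-elim (¬qx (P⊆Q px))
    ... | no _   | yes _  = ≤-trans (∑-filter-⊆ P? Q? P⊆Q xs) (p≤q+p (f≥0 x))
    ... | no _   | no _   = ∑-filter-⊆ P? Q? P⊆Q xs

    ∑-filter-∪ : ∀ {P Q R : Pred A 0ℓ} (P? : Decidable P) (Q? : Decidable Q) (R? : Decidable R) →
                 P ⊆ R → Q ⊆ R → ∀ {xs} → All (λ x → P x → ¬ Q x) xs →
                 ∑ f (filter P? xs) + ∑ f (filter Q? xs) ≤ ∑ f (filter R? xs)
    ∑-filter-∪ P? Q? R? P⊆R Q⊆R {[]}     []             = ≤-reflexive (ℚ.+-identityʳ 0ℚ)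
    ∑-filter-∪ P? Q? R? P⊆R Q⊆R {x ∷ xs} (disj ∷ disjs) with P? x | Q? x | R? x
    ... | yes px | yes qx | _      = ⊥-elim (disj px qx)
    ... | yes px | no _   | no ¬rx = ⊥-elim (¬rx (P⊆R px))
    ... | no _   | yes qx | no ¬rx = ⊥-elim (¬rx (Q⊆R qx))
    ... | yes _  | no _   | yes _  = begin
      f x + p + q    ≡⟨ ℚ.+-assoc (f x) p q ⟩
      f x + (p + q)  ≤⟨ +-monoʳ-≤ (f x) ih ⟩
      f x + r        ∎
      where
      open ℚ.≤-Reasoning
      p = ∑ f (filter P? xs); q = ∑ f (filter Q? xs); r = ∑ f (filter R? xs)
      ih = ∑-filter-∪ P? Q? R? P⊆R Q⊆R disjs
    ... | no _   | yes _  | yes _  = begin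
      p + (f x + q)  ≡⟨ solve 3 (λ p a q → p :+ (a :+ q) := a :+ (p :+ q)) refl p (f x) q ⟩
      f x + (p + q)  ≤⟨ +-monoʳ-≤ (f x) (∑-filter-∪ P? Q? R? P⊆R Q⊆R disjs) ⟩
      f x + r        ∎
      where
      open ℚ.≤-Reasoning
      p = ∑ f (filter P? xs); q = ∑ f (filter Q? xs); r = ∑ f (filter R? xs)
    ... | no _   | no _   | yes _  = ≤-trans (∑-filter-∪ P? Q? R? P⊆R Q⊆R disjs) (p≤q+p (f≥0 x))
    ... | no _   | no _   | no _   = ∑-filter-∪ P? Q? R? P⊆R Q⊆R disjs

  module _ {P Q : Pred A 0ℓ} (P? : Decidable P) (Q? : Decidable Q) (P⊆Q : P ⊆ Q) where

    length-filter-⊆ : ∀ xs → length (filter P? xs) ℕ.≤ length (filter Q? xs)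
    length-filter-⊆ []       = z≤n
    length-filter-⊆ (x ∷ xs) with P? x | Q? x
    ... | yes _  | yes _  = s≤s (length-filter-⊆ xs)
    ... | yes px | no ¬qx = ⊥-elim (¬qx (P⊆Q px))
    ... | no _   | yes _  = ℕ.m≤n⇒m≤1+n (length-filter-⊆ xs)
    ... | no _   | no _   = length-filter-⊆ xs

    length-filter-⊂ : ∀ {x xs} → x ∈ xs → Q x → ¬ P x → length (filter P? xs) ℕ.< length (filter Q? xs)
    length-filter-⊂ {xs = y ∷ xs} x∈xs qx ¬px with P? y | Q? y | x∈xs
    ... | yes py | _      | here refl = ⊥-elim (¬px py)
    ... | _      | no ¬qy | here refl = ⊥-elim (¬qy qx)
    ... | no _   | yes _  | here refl = s≤s (length-filter-⊆ xs)
    ... | yes _  | yes _  | there x∈ys  = s≤s (length-filter-⊂ x∈ys qx ¬px)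
    ... | yes py | no ¬qy | there _     = ⊥-elim (¬qy (P⊆Q py))
    ... | no _   | yes _  | there x∈ys  = ℕ.m≤n⇒m≤1+n (length-filter-⊂ x∈ys qx ¬px)
    ... | no _   | no _   | there x∈ys  = length-filter-⊂ x∈ys qx ¬px

module _ {A : Set} where

  nonempty⇒∈ : ∀ {xs : List A} → 1 ℕ.≤ length xs → ∃[ x ] (x ∈ xs)
  nonempty⇒∈ {x ∷ _} _ = x , here refl

  length≡1⇒≡ : ∀ {xs : List A} {x y} → length xs ≡ 1 → x ∈ xs → y ∈ xs → x ≡ y
  length≡1⇒≡ {_ ∷ []} _ (here refl) (here refl) = refl

  Unique-resp-↭ : ∀ {xs ys : List A} → xs ↭ ys → Unique xs → Unique ys
  Unique-resp-↭ p = ↭ₛ.Unique-resp-↭ (setoid A) (↭⇒↭ₛ p)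

  Unique-++⁻ˡ : ∀ (xs : List A) {ys} → Unique (xs ++ ys) → Unique xs
  Unique-++⁻ˡ []       _          = []
  Unique-++⁻ˡ (x ∷ xs) (x∉ ∷ u) = All-++⁻ˡ xs x∉ ∷ Unique-++⁻ˡ xs u

  Unique-++⁻ʳ : ∀ (xs : List A) {ys} → Unique (xs ++ ys) → Unique ys
  Unique-++⁻ʳ []       u       = u
  Unique-++⁻ʳ (x ∷ xs) (_ ∷ u) = Unique-++⁻ʳ xs u

  Unique-++⇒disjoint : ∀ (xs : List A) {ys a} → Unique (xs ++ ys) → a ∈ xs → a ∉ ys
  Unique-++⇒disjoint (x ∷ xs) (x∉ ∷ _) (here refl) a∈ys = All.lookup x∉ (∈-++⁺ʳ xs a∈ys) refl
  Unique-++⇒disjoint (x ∷ xs) (_ ∷ u)  (there a∈xs) a∈ys = Unique-++⇒disjoint xs u a∈xs a∈ys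

  module _ {B : Set} (f : B → List A) where

    concatMap-↭ : ∀ {xs ys} → xs ↭ ys → concatMap f xs ↭ concatMap f ys
    concatMap-↭ _↭_.refl         = ↭-refl
    concatMap-↭ (_↭_.prep x p)   = ++⁺ˡ (f x) (concatMap-↭ p)
    concatMap-↭ (_↭_.swap x y p) = ↭-trans (shifts (f x) (f y)) (++⁺ˡ (f y) (++⁺ˡ (f x) (concatMap-↭ p)))
    concatMap-↭ (_↭_.trans p q)  = ↭-trans (concatMap-↭ p) (concatMap-↭ q)

    Unique-concatMap⇒≡ : ∀ {bs b b′ a} → Unique (concatMap f bs) →
                         b ∈ bs → b′ ∈ bs → a ∈ f b → a ∈ f b′ → b ≡ b′
    Unique-concatMap⇒≡ {c ∷ _} u (here refl) (here refl) _ _ = refl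
    Unique-concatMap⇒≡ {c ∷ _} u (here refl) (there b′∈bs) a∈fc a∈fb′ =
      ⊥-elim (Unique-++⇒disjoint (f c) u a∈fc (∈-concatMap⁺ f (lose b′∈bs a∈fb′)))
    Unique-concatMap⇒≡ {c ∷ _} u (there b∈bs) (here refl) a∈fb a∈fc =
      ⊥-elim (Unique-++⇒disjoint (f c) u a∈fc (∈-concatMap⁺ f (lose b∈bs a∈fb)))
    Unique-concatMap⇒≡ {c ∷ _} u (there b∈bs) (there b′∈bs) a∈fb a∈fb′ =
      Unique-concatMap⇒≡ (Unique-++⁻ʳ (f c) u) b∈bs b′∈bs a∈fb a∈fb′

  filter-partition-↭ : ∀ {P : Pred A 0ℓ} (P? : Decidable P) xs → xs ↭ filter P? xs ++ filter (∁? P?) xs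
  filter-partition-↭ P? []       = ↭-refl
  filter-partition-↭ P? (x ∷ xs) with P? x
  ... | yes _ = ↭-prep x (filter-partition-↭ P? xs)
  ... | no  _ = ↭-trans (↭-prep x (filter-partition-↭ P? xs)) (↭-sym (shift x (filter P? xs) _))

-- Cycles and paths as vertex lists

module _ {A : Set} where

  lastOf-∈ : ∀ (y : A) r → lastOf y r ∈ y ∷ r
  lastOf-∈ y []      = here refl
  lastOf-∈ y (z ∷ r) = there (lastOf-∈ z r)

  lastOf-∷ʳ : ∀ (y : A) r x → lastOf y (r ∷ʳ x) ≡ x
  lastOf-∷ʳ y []      x = refl
  lastOf-∷ʳ y (z ∷ r) x = lastOf-∷ʳ z r x

  consec-∷ʳ : ∀ (y : A) r x → consec (y ∷ r ∷ʳ x) ≡ consec (y ∷ r) ∷ʳ (lastOf y r , x)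
  consec-∷ʳ y []      x = refl
  consec-∷ʳ y (z ∷ r) x = cong ((y , z) ∷_) (consec-∷ʳ z r x)

  consec-split : ∀ (L : List A) d R → consec (L ++ d ∷ R) ≡ consec (L ∷ʳ d) ++ consec (d ∷ R)
  consec-split []           d R = refl
  consec-split (x ∷ [])     d R = refl
  consec-split (x ∷ y ∷ L)  d R = cong ((x , y) ∷_) (consec-split (y ∷ L) d R)

  consec-∈⇒split : ∀ {c : List A} {a b} → (a , b) ∈ consec c → ∃[ L ] ∃[ R ] (c ≡ L ++ a ∷ b ∷ R)
  consec-∈⇒split {x ∷ y ∷ r} (here refl) = [] , r , refl
  consec-∈⇒split {x ∷ y ∷ r} (there ab∈) with consec-∈⇒split ab∈
  ... | L , R , eq = x ∷ L , R , cong (x ∷_) eq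

  consec-∈ : ∀ {c : List A} {a b} → (a , b) ∈ consec c → a ∈ c × b ∈ c
  consec-∈ {x ∷ y ∷ r} (here refl)  = here refl , there (here refl)
  consec-∈ {x ∷ y ∷ r} (there ab∈) with consec-∈ ab∈
  ... | a∈ , b∈ = there a∈ , there b∈

  consec⊆cycleEdges : ∀ {c : List A} {e} → e ∈ consec c → e ∈ cycleEdges c
  consec⊆cycleEdges {x ∷ y ∷ r} e∈ = ∈-++⁺ˡ e∈

  cycleEdges-∈ : ∀ {c : List A} {a b} → (a , b) ∈ cycleEdges c → a ∈ c × b ∈ c
  cycleEdges-∈ {x ∷ y ∷ r} ab∈ with ∈-++⁻ (consec (x ∷ y ∷ r)) ab∈
  ... | inj₁ ab∈consec    = consec-∈ ab∈consec
  ... | inj₂ (here refl)  = there (lastOf-∈ y r) , here refl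

  cycleEdges-∷ʳ : ∀ (y : A) r x → cycleEdges (y ∷ r ∷ʳ x) ≡ consec (y ∷ r ∷ʳ x) ∷ʳ (x , y)
  cycleEdges-∷ʳ y []      x = refl
  cycleEdges-∷ʳ y (z ∷ r) x = cong (λ l → consec (y ∷ z ∷ r ∷ʳ x) ∷ʳ (l , y)) (lastOf-∷ʳ z r x)

  cycleEdges-rotate₁ : ∀ (x : A) xs → cycleEdges (x ∷ xs) ↭ cycleEdges (xs ∷ʳ x)
  cycleEdges-rotate₁ x []      = ↭-refl
  cycleEdges-rotate₁ x (y ∷ r) = begin
    (x , y) ∷ consec (y ∷ r) ∷ʳ (lastOf y r , x)     ↭⟨ ∷↭∷ʳ (x , y) _ ⟩
    (consec (y ∷ r) ∷ʳ (lastOf y r , x)) ∷ʳ (x , y)  ≡⟨ cong (_∷ʳ (x , y)) (consec-∷ʳ y r x) ⟨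
    consec (y ∷ r ∷ʳ x) ∷ʳ (x , y)                   ≡⟨ cycleEdges-∷ʳ y r x ⟨
    cycleEdges (y ∷ r ∷ʳ x)                          ∎
    where open PermutationReasoning

  cycleEdges-rotate : ∀ (xs ys : List A) → cycleEdges (xs ++ ys) ↭ cycleEdges (ys ++ xs)
  cycleEdges-rotate []       ys = ↭-reflexive (cong cycleEdges (sym (List.++-identityʳ ys)))
  cycleEdges-rotate (x ∷ xs) ys = begin
    cycleEdges (x ∷ xs ++ ys)        ↭⟨ cycleEdges-rotate₁ x (xs ++ ys) ⟩
    cycleEdges ((xs ++ ys) ∷ʳ x)     ≡⟨ cong cycleEdges (List.++-assoc xs ys [ x ]) ⟩
    cycleEdges (xs ++ ys ∷ʳ x)       ↭⟨ cycleEdges-rotate xs (ys ∷ʳ x) ⟩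
    cycleEdges ((ys ∷ʳ x) ++ xs)     ≡⟨ cong cycleEdges (List.++-assoc ys [ x ] xs) ⟩
    cycleEdges (ys ++ x ∷ xs)        ∎
    where open PermutationReasoning

  cycle-rotate-to : ∀ {c : List A} {x} → x ∈ c → ∃[ t ] ((c ↭ x ∷ t) × (cycleEdges c ↭ cycleEdges (x ∷ t)))
  cycle-rotate-to x∈c with ∈-∃++ x∈c
  ... | L , R , refl = R ++ L , ++-comm L (_ ∷ R) , cycleEdges-rotate L (_ ∷ R)

  cycle-open-at : ∀ {c : List A} {a b} → (a , b) ∈ cycleEdges c →
                  ∃[ p ] ((c ↭ p) × (cycleEdges c ↭ consec p ∷ʳ (a , b)))
  cycle-open-at {x ∷ y ∷ r} ab∈ with ∈-++⁻ (consec (x ∷ y ∷ r)) ab∈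
  ... | inj₂ (here refl) = x ∷ y ∷ r , ↭-refl , ↭-refl
  cycle-open-at {x ∷ y ∷ r} {a} {b} _ | inj₁ ab∈consec with consec-∈⇒split ab∈consec
  ... | L , R , eq = p , c↭p , edges
    where
    p = b ∷ (R ++ L) ∷ʳ a
    c≡ : x ∷ y ∷ r ≡ (L ∷ʳ a) ++ (b ∷ R)
    c≡ = Eq.trans eq (sym (List.++-assoc L [ a ] (b ∷ R)))
    p≡ : (b ∷ R) ++ (L ∷ʳ a) ≡ p
    p≡ = cong (b ∷_) (sym (List.++-assoc R L [ a ]))
    c↭p : x ∷ y ∷ r ↭ p
    c↭p = Eq.subst (_↭ p) (sym c≡) (↭-trans (++-comm (L ∷ʳ a) (b ∷ R)) (↭-reflexive p≡))
    edges : cycleEdges (x ∷ y ∷ r) ↭ consec p ∷ʳ (a , b)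
    edges = Eq.subst (λ c → cycleEdges c ↭ consec p ∷ʳ (a , b)) (sym c≡)
      (↭-trans (cycleEdges-rotate (L ∷ʳ a) (b ∷ R))
               (↭-reflexive (Eq.trans (cong cycleEdges p≡) (cycleEdges-∷ʳ b (R ++ L) a))))

  consec-leaves : ∀ {P : Pred A 0ℓ} (P? : Decidable P) {z r y} → P z → y ∈ z ∷ r → ¬ P y →
                  ∃[ a ] ∃[ b ] ((a , b) ∈ consec (z ∷ r) × P a × ¬ P b)
  consec-leaves P?              pz (here refl) ¬py = ⊥-elim (¬py pz)
  consec-leaves P? {z} {z′ ∷ r} pz (there y∈r) ¬py with P? z′
  ... | no ¬pz′ = z , z′ , here refl , pz , ¬pz′
  ... | yes pz′ with consec-leaves P? pz′ y∈r ¬py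
  ... | a , b , ab∈ , pa , ¬pb = a , b , there ab∈ , pa , ¬pb

  consec-crosses : ∀ {P : Pred A 0ℓ} (P? : Decidable P) {c x y} → x ∈ c → P x → y ∈ c → ¬ P y →
                   ∃[ a ] ∃[ b ] ((a , b) ∈ consec c × ((P a × ¬ P b) ⊎ (¬ P a × P b)))
  consec-crosses P? {z ∷ r} x∈c px y∈c ¬py with P? z
  ... | yes pz with consec-leaves P? pz y∈c ¬py
  ...   | a , b , ab∈ , pa , ¬pb = a , b , ab∈ , inj₁ (pa , ¬pb)
  consec-crosses P? {z ∷ r} x∈c px y∈c ¬py | no ¬pz with consec-leaves (∁? P?) ¬pz x∈c (λ ¬px → ¬px px)
  ...   | a , b , ab∈ , ¬pa , ¬¬pb = a , b , ab∈ , inj₂ (¬pa , decidable-stable (P? b) ¬¬pb)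

module _ {A : Set} (w : A → A → ℚ) where

  wsum≡∑ : ∀ es → wsum w es ≡ ∑ (uncurry w) es
  wsum≡∑ []       = refl
  wsum≡∑ (e ∷ es) = cong (uncurry w e +_) (wsum≡∑ es)

  wsum-++ : ∀ es fs → wsum w (es ++ fs) ≡ wsum w es + wsum w fs
  wsum-++ es fs = Eq.trans (wsum≡∑ (es ++ fs))
    (Eq.trans (∑-++ (uncurry w) es fs) (sym (cong₂ _+_ (wsum≡∑ es) (wsum≡∑ fs))))

  wsum-↭ : ∀ {es fs} → es ↭ fs → wsum w es ≡ wsum w fs
  wsum-↭ {es} {fs} p = Eq.trans (wsum≡∑ es) (Eq.trans (∑-↭ (uncurry w) p) (sym (wsum≡∑ fs)))

  wsum-nonNeg : (∀ a b → 0ℚ ≤ w a b) → ∀ es → 0ℚ ≤ wsum w es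
  wsum-nonNeg w≥0 es = ≤-trans (∑-nonNeg (uncurry w≥0) es) (≤-reflexive (sym (wsum≡∑ es)))

  pathW : List A → ℚ
  pathW xs = wsum w (consec xs)

  pathW-split : ∀ L d R → pathW (L ++ d ∷ R) ≡ pathW (L ∷ʳ d) + pathW (d ∷ R)
  pathW-split L d R = Eq.trans (cong (wsum w) (consec-split L d R)) (wsum-++ (consec (L ∷ʳ d)) _)

  pathW-reverse : (∀ a b → w a b ≡ w b a) → ∀ xs → pathW (reverse xs) ≡ pathW xs
  pathW-reverse w-sym []          = refl
  pathW-reverse w-sym (x ∷ [])    = refl
  pathW-reverse w-sym (x ∷ y ∷ r) = begin
    pathW (reverse (x ∷ y ∷ r))
      ≡⟨ cong pathW reverse≡ ⟩
    pathW (reverse r ++ y ∷ [ x ])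
      ≡⟨ pathW-split (reverse r) y [ x ] ⟩
    pathW (reverse r ∷ʳ y) + (w y x + 0ℚ)
      ≡⟨ cong₂ (λ p q → pathW p + (q + 0ℚ)) (sym (List.unfold-reverse y r)) (w-sym y x) ⟩
    pathW (reverse (y ∷ r)) + (w x y + 0ℚ)
      ≡⟨ cong (λ p → p + (w x y + 0ℚ)) (pathW-reverse w-sym (y ∷ r)) ⟩
    pathW (y ∷ r) + (w x y + 0ℚ)
      ≡⟨ solve 2 (λ p q → p :+ (q :+ con 0ℚ) := q :+ p) refl (pathW (y ∷ r)) (w x y) ⟩
    pathW (x ∷ y ∷ r) ∎
    where
    open Eq.≡-Reasoning
    reverse≡ : reverse (x ∷ y ∷ r) ≡ reverse r ++ y ∷ [ x ]
    reverse≡ = Eq.trans (List.unfold-reverse x (y ∷ r))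
      (Eq.trans (cong (_∷ʳ x) (List.unfold-reverse y r)) (List.++-assoc (reverse r) [ y ] [ x ]))

  maxEdgeW : List (A × A) → ℚ
  maxEdgeW = foldr (λ e m → uncurry w e ⊔ m) 0ℚ

  maxEdgeW-nonNeg : ∀ es → 0ℚ ≤ maxEdgeW es
  maxEdgeW-nonNeg []       = ≤-refl
  maxEdgeW-nonNeg (e ∷ es) = ≤-trans (maxEdgeW-nonNeg es) (ℚ.p≤q⊔p (uncurry w e) _)

  maxEdgeW-≥ : ∀ {e es} → e ∈ es → uncurry w e ≤ maxEdgeW es
  maxEdgeW-≥ {e} {_ ∷ es} (here refl) = ℚ.p≤p⊔q (uncurry w e) (maxEdgeW es)
  maxEdgeW-≥ {_} {f ∷ es} (there e∈) = ≤-trans (maxEdgeW-≥ e∈) (ℚ.p≤q⊔p (uncurry w f) _)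

  module _ (w≥0 : ∀ a b → 0ℚ ≤ w a b) where

    maxEdgeW-attained : ∀ e es → ∃[ e′ ] (e′ ∈ e ∷ es × maxEdgeW (e ∷ es) ≤ uncurry w e′)
    maxEdgeW-attained e []        = e , here refl , ℚ.⊔-lub ≤-refl (uncurry w≥0 e)
    maxEdgeW-attained e (f ∷ es) with ℚ.⊔-sel (uncurry w e) (maxEdgeW (f ∷ es))
    ... | inj₁ max≡e = e , here refl , ≤-reflexive max≡e
    ... | inj₂ max≡m with maxEdgeW-attained f es
    ...   | e′ , e′∈ , m≤e′ = e′ , there e′∈ , ≤-trans (≤-reflexive max≡m) m≤e′

    cycle-open-at-heaviest : ∀ c → ∃[ p ] ((c ↭ p) × (pathW p + maxEdgeW (cycleEdges c) ≤ wsum w (cycleEdges c)))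
    cycle-open-at-heaviest []          = [] , ↭-refl , ≤-reflexive (ℚ.+-identityʳ 0ℚ)
    cycle-open-at-heaviest (x ∷ [])    = x ∷ [] , ↭-refl , ≤-reflexive (ℚ.+-identityʳ 0ℚ)
    cycle-open-at-heaviest (x ∷ y ∷ r) with maxEdgeW-attained (x , y) (consec (y ∷ r) ∷ʳ (lastOf y r , x))
    ... | e , e∈ , max≤e with cycle-open-at e∈
    ...   | p , c↭p , edges↭ = p , c↭p , (begin
      pathW p + maxEdgeW (cycleEdges (x ∷ y ∷ r))   ≤⟨ +-monoʳ-≤ (pathW p) max≤e ⟩
      pathW p + uncurry w e                         ≡⟨ cong (pathW p +_) (ℚ.+-identityʳ (uncurry w e)) ⟨
      pathW p + (uncurry w e + 0ℚ)                  ≡⟨ wsum-++ (consec p) [ e ] ⟨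
      wsum w (consec p ∷ʳ e)                        ≡⟨ wsum-↭ edges↭ ⟨
      wsum w (cycleEdges (x ∷ y ∷ r))               ∎)
      where open ℚ.≤-Reasoning

  wsum-partition : ∀ {P : Pred (A × A) 0ℓ} (P? : Decidable P) es →
                   wsum w es ≡ wsum w (filter P? es) + wsum w (filter (∁? P?) es)
  wsum-partition P? es = Eq.trans (wsum≡∑ es) (Eq.trans (∑-partition (uncurry w) P? es)
    (sym (cong₂ _+_ (wsum≡∑ (filter P? es)) (wsum≡∑ (filter (∁? P?) es)))))

  wsum-filter-concatMap : ∀ {B : Set} {P : Pred (A × A) 0ℓ} (P? : Decidable P) (f : B → List (A × A)) bs →
                          ∑ (λ b → wsum w (filter P? (f b))) bs ≡ wsum w (filter P? (concatMap f bs))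
  wsum-filter-concatMap P? f []       = refl
  wsum-filter-concatMap P? f (b ∷ bs) = Eq.trans
    (cong (wsum w (filter P? (f b)) +_) (wsum-filter-concatMap P? f bs))
    (Eq.trans (sym (wsum-++ (filter P? (f b)) _)) (cong (wsum w) (sym (List.filter-++ P? (f b) (concatMap f bs)))))

-- Edge lists as graphs

module _ {A : Set} where

  UEdge-mono : ∀ {es fs : List (A × A)} → es ⊆ᴸ fs → ∀ {a b} → UEdge es a b → UEdge fs a b
  UEdge-mono es⊆fs (inj₁ ab∈) = inj₁ (es⊆fs ab∈)
  UEdge-mono es⊆fs (inj₂ ba∈) = inj₂ (es⊆fs ba∈)

  UEdge-sym : ∀ {es : List (A × A)} {a b} → UEdge es a b → UEdge es b a
  UEdge-sym (inj₁ ab∈) = inj₂ ab∈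
  UEdge-sym (inj₂ ba∈) = inj₁ ba∈

  Conn-mono : ∀ {es fs : List (A × A)} → es ⊆ᴸ fs → ∀ {a b} → Conn es a b → Conn fs a b
  Conn-mono es⊆fs here       = here
  Conn-mono es⊆fs (step e p) = step (UEdge-mono es⊆fs e) (Conn-mono es⊆fs p)

  Conn-trans : ∀ {es : List (A × A)} {a b c} → Conn es a b → Conn es b c → Conn es a c
  Conn-trans here       q = q
  Conn-trans (step e p) q = step e (Conn-trans p q)

  Conn-sym : ∀ {es : List (A × A)} {a b} → Conn es a b → Conn es b a
  Conn-sym here       = here
  Conn-sym (step e p) = Conn-trans (Conn-sym p) (step (UEdge-sym e) here)

  HasCycle-mono : ∀ {es fs : List (A × A)} → es ⊆ᴸ fs → HasCycle es → HasCycle fs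
  HasCycle-mono es⊆fs (c , u , len , edges) = c , u , len , All.map (UEdge-mono es⊆fs) edges

  Avoids : A → List (A × A) → Set
  Avoids y es = ∀ {p q} → (p , q) ∈ es → p ≢ y × q ≢ y

  module _ {y a : A} {es : List (A × A)} (avoids : Avoids y es) where

    pendant-unique : Unique es → Unique ((y , a) ∷ es)
    pendant-unique u = All.tabulate (λ e∈ ya≡e → proj₁ (avoids e∈) (sym (cong proj₁ ya≡e))) ∷ u

    pendant-noReverse : y ≢ a → (∀ {p q} → (p , q) ∈ es → (q , p) ∉ es) →
                        ∀ {p q} → (p , q) ∈ (y , a) ∷ es → (q , p) ∉ (y , a) ∷ es
    pendant-noReverse y≢a noRev (here refl) (here refl)  = y≢a refl
    pendant-noReverse y≢a noRev (here refl) (there ay∈)  = proj₂ (avoids ay∈) refl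
    pendant-noReverse y≢a noRev (there ya∈) (here refl)  = proj₂ (avoids ya∈) refl
    pendant-noReverse y≢a noRev (there pq∈) (there qp∈) = noRev pq∈ qp∈

    pendant-acyclic : DecidableEquality A → y ≢ a → ¬ HasCycle es → ¬ HasCycle ((y , a) ∷ es)
    pendant-acyclic _≟_ y≢a acyclic (c , u , 3≤len , edges) with any? (y ≟_) c
    ... | no y∉c = acyclic (c , u , 3≤len , All.tabulate (λ pq∈ → drop (cycleEdges-∈ pq∈) (All.lookup edges pq∈)))
      where
      drop : ∀ {p q} → p ∈ c × q ∈ c → UEdge ((y , a) ∷ es) p q → UEdge es p q
      drop (p∈c , _) (inj₁ (here refl)) = ⊥-elim (y∉c p∈c)
      drop _         (inj₁ (there pq∈)) = inj₁ pq∈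
      drop (_ , q∈c) (inj₂ (here refl)) = ⊥-elim (y∉c q∈c)
      drop _         (inj₂ (there qp∈)) = inj₂ qp∈
    ... | yes y∈c with cycle-rotate-to y∈c
    ... | t , c↭ , edges↭ =
      two-neighbours t (Unique-resp-↭ c↭ u) (Eq.subst (3 ℕ.≤_) (↭-length c↭) 3≤len) (All-resp-↭ edges↭ edges)
      where
      neighbour≡a : ∀ {v} → UEdge ((y , a) ∷ es) y v → v ≡ a
      neighbour≡a (inj₁ (here refl))  = refl
      neighbour≡a (inj₁ (there yv∈)) = ⊥-elim (proj₁ (avoids yv∈) refl)
      neighbour≡a (inj₂ (here refl))  = ⊥-elim (y≢a refl)
      neighbour≡a (inj₂ (there vy∈)) = ⊥-elim (proj₂ (avoids vy∈) refl)
      -- y has two distinct neighbours on the cycle, but its only incident edge is (y , a).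
      two-neighbours : ∀ t → Unique (y ∷ t) → 3 ℕ.≤ length (y ∷ t) →
                       ¬ All (λ e → UEdge ((y , a) ∷ es) (proj₁ e) (proj₂ e)) (cycleEdges (y ∷ t))
      two-neighbours (v ∷ v′ ∷ t′) (_ ∷ (v∉ ∷ _)) (s≤s (s≤s (s≤s z≤n))) (first ∷ rest) =
        All.lookup v∉ (lastOf-∈ v′ t′) (Eq.trans (neighbour≡a first) (sym (neighbour≡a (UEdge-sym last))))
        where
        last : UEdge ((y , a) ∷ es) (lastOf v′ t′) y
        last = All.lookup rest (∈-++⁺ʳ (consec (v ∷ v′ ∷ t′)) (here refl))

-- Greedy merging of a forest

module _ {n : ℕ} where

  open DecMembership (Fin._≟_ {n}) using (_∈?_)

  Covers : List (Tree {n}) → Set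
  Covers Ts = ∀ v → Any (λ T → v ∈ verts T) Ts

  Saturated : List (Tree {n}) → List (Fin n) → Set
  Saturated Ts X = ∀ {a b} → SameTree Ts a b → a ∈ X → b ∈ X

  Saturated-concat : ∀ {Ts} Ns → All (λ T → Saturated Ts (verts T)) Ns → Saturated Ts (concatMap verts Ns)
  Saturated-concat Ns sats same a∈ with find (∈-concatMap⁻ verts {xs = Ns} a∈)
  ... | T , T∈ , a∈T = ∈-concatMap⁺ verts {xs = Ns} (lose T∈ (All.lookup sats T∈ same a∈T))

  module _ {Ts : List (Tree {n})} {T₁ T₂ : Tree {n}} {rest : List (Tree {n})} (Ts↭ : Ts ↭ T₁ ∷ T₂ ∷ rest) where

    merge-covers : ∀ e → Covers Ts → Covers (merge T₁ T₂ e ∷ rest)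
    merge-covers e covers v with Any-resp-↭ Ts↭ (covers v)
    ... | here v∈T₁         = here (∈-++⁺ˡ v∈T₁)
    ... | there (here v∈T₂) = here (∈-++⁺ʳ (verts T₁) v∈T₂)
    ... | there (there v∈)  = there v∈

    merge-saturated : ∀ {u v X} → u ∈ verts T₁ → v ∈ verts T₂ → Saturated Ts X →
                      (u ∈ X → v ∈ X) → (v ∈ X → u ∈ X) → Saturated (merge T₁ T₂ (u , v) ∷ rest) X
    merge-saturated {u} {v} {X} u∈T₁ v∈T₂ sat u⇒v v⇒u = saturated
      where
      same₁ : ∀ {x y} → x ∈ verts T₁ → y ∈ verts T₁ → SameTree Ts x y
      same₁ x∈ y∈ = Any-resp-↭ (↭-sym Ts↭) (here (x∈ , y∈))
      same₂ : ∀ {x y} → x ∈ verts T₂ → y ∈ verts T₂ → SameTree Ts x y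
      same₂ x∈ y∈ = Any-resp-↭ (↭-sym Ts↭) (there (here (x∈ , y∈)))
      across : ∀ {x y} → x ∈ verts T₁ ⊎ x ∈ verts T₂ → y ∈ verts T₁ ⊎ y ∈ verts T₂ → x ∈ X → y ∈ X
      across (inj₁ x∈) (inj₁ y∈) = sat (same₁ x∈ y∈)
      across (inj₂ x∈) (inj₂ y∈) = sat (same₂ x∈ y∈)
      across (inj₁ x∈) (inj₂ y∈) x∈X = sat (same₂ v∈T₂ y∈) (u⇒v (sat (same₁ x∈ u∈T₁) x∈X))
      across (inj₂ x∈) (inj₁ y∈) x∈X = sat (same₁ u∈T₁ y∈) (v⇒u (sat (same₂ x∈ v∈T₂) x∈X))
      saturated : Saturated (merge T₁ T₂ (u , v) ∷ rest) X
      saturated (here (x∈ , y∈)) = across (∈-++⁻ (verts T₁) x∈) (∈-++⁻ (verts T₁) y∈)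
      saturated (there same)     = sat (Any-resp-↭ (↭-sym Ts↭) (there (there same)))

  module _ (w : Fin n → Fin n → ℚ) (w-sym : ∀ a b → w a b ≡ w b a) where

    CrossingAtMost : List (Edge {n}) → List (Fin n) → ℚ → Set
    CrossingAtMost Es X ℓ = ∃[ x ] ∃[ y ] (UEdge Es x y × x ∈ X × y ∉ X × w x y ≤ ℓ)

    private
      crossing-∷ : ∀ {Es X ℓ} e → CrossingAtMost Es X ℓ → CrossingAtMost (e ∷ Es) X ℓ
      crossing-∷ e (x , y , xy , rest) = x , y , UEdge-mono there xy , rest

    -- The first greedy step joining a tree inside X to one outside uses a lightest edge
    -- between distinct trees, and {a , b} is a candidate at that step.
    dagger-cut : ∀ {Ts Es} → Dagger w Ts Es → Covers Ts → ∀ {X} → Saturated Ts X →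
                 ∀ {a b} → a ∈ X → b ∉ X → CrossingAtMost Es X (w a b)
    dagger-cut done covers sat {a} {b} a∈X b∉X with covers a | covers b
    ... | here a∈T | here b∈T = ⊥-elim (b∉X (sat (here (a∈T , b∈T)) a∈X))
    dagger-cut (join {u = u} {v} Ts↭ u∈T₁ v∈T₂ lightest Es) covers {X} sat {a} {b} a∈X b∉X
      with u ∈? X | v ∈? X
    ... | yes u∈X | no v∉X = u , v , inj₁ (here refl) , u∈X , v∉X , lightest a b (λ ab → b∉X (sat ab a∈X))
    ... | no u∉X | yes v∈X = v , u , inj₂ (here refl) , v∈X , u∉X ,
                             ≤-trans (≤-reflexive (w-sym v u)) (lightest a b (λ ab → b∉X (sat ab a∈X)))
    ... | yes u∈X | yes v∈X = crossing-∷ (u , v)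
      (dagger-cut Es (merge-covers Ts↭ (u , v) covers)
        (merge-saturated Ts↭ u∈T₁ v∈T₂ sat (λ _ → v∈X) (λ _ → u∈X)) a∈X b∉X)
    ... | no u∉X  | no v∉X  = crossing-∷ (u , v)
      (dagger-cut Es (merge-covers Ts↭ (u , v) covers)
        (merge-saturated Ts↭ u∈T₁ v∈T₂ sat (λ u∈X → ⊥-elim (u∉X u∈X)) (λ v∈X → ⊥-elim (v∉X v∈X))) a∈X b∉X)

module Setting {n : ℕ} (D : Subset n) (k : ℕ) (w : Fin n → Fin n → ℚ) (metric : IsMetric w)
  (Cs : List (List (Fin n))) (λ* : ℚ) (optimal : IsOptimalCover D k w Cs λ*)
  (d⋆ : Fin n → Fin n) (argmin : IsArgminChoice D w d⋆)
  (T̂ : List (Maybe (Fin n) × Maybe (Fin n))) (mst : MST (ŵ w d⋆) (contractedVerts D) T̂)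
  (Ts : List Tree) (trees : IsTreesOf (Fstar d⋆ T̂) Ts)
  (E† : List Edge) (dagger : Dagger w Ts E†) where

  open Types w Cs λ*
  open DecMembership (Fin._≟_ {n}) using (_∈?_)

  w-zero : ∀ a → w a a ≡ 0ℚ
  w-zero = proj₁ metric

  w-nonNeg : ∀ a b → 0ℚ ≤ w a b
  w-nonNeg = proj₁ (proj₂ metric)

  w-sym : ∀ a b → w a b ≡ w b a
  w-sym = proj₁ (proj₂ (proj₂ metric))

  w-tri : ∀ a b c → w a c ≤ w a b + w b c
  w-tri = proj₂ (proj₂ (proj₂ metric))

  treeW-nonNeg : ∀ T → 0ℚ ≤ treeW w T
  treeW-nonNeg T = wsum-nonNeg w w-nonNeg (tedges T)

  Depot : Fin n → Set
  Depot v = v Sub.∈ D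

  depot? : Decidable Depot
  depot? v = v Sub.∈? D

  cycles-wf : All (λ c → (1 ℕ.≤ length c) × Unique c × (length (depotsIn D c) ≡ 1)) Cs
  cycles-wf = proj₁ (proj₂ (proj₁ optimal))

  cycles-cover : ∀ v → Any (v ∈_) Cs
  cycles-cover = proj₂ (proj₂ (proj₂ (proj₁ optimal)))

  cycleW≤λ* : All (λ c → cycleW w c ≤ λ*) Cs
  cycleW≤λ* = proj₁ (proj₂ optimal)

  λ*-nonNeg : 0ℚ ≤ λ*
  λ*-nonNeg with find (proj₁ (proj₂ (proj₂ optimal)))
  ... | c , _ , cycleW≡λ* = ≤-trans (wsum-nonNeg w w-nonNeg (cycleEdges c)) (≤-reflexive cycleW≡λ*)

  depot-unique : ∀ {c} → c ∈ Cs → ∀ {x y} → x ∈ c → y ∈ c → Depot x → Depot y → x ≡ y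
  depot-unique c∈ x∈c y∈c x-depot y-depot = length≡1⇒≡ (proj₂ (proj₂ (All.lookup cycles-wf c∈)))
    (∈-filter⁺ depot? x∈c x-depot) (∈-filter⁺ depot? y∈c y-depot)

  maxW : List (Fin n) → ℚ
  maxW c = maxEdgeW w (cycleEdges c)

  maxW-nonNeg : ∀ c → 0ℚ ≤ maxW c
  maxW-nonNeg c = maxEdgeW-nonNeg w (cycleEdges c)

  Partition : List Tree → Set
  Partition F = concatMap verts F ↭ allFin n

  verts↭ : Partition Ts
  verts↭ = proj₁ trees

  edges↭ : concatMap tedges Ts ↭ Fstar d⋆ T̂
  edges↭ = proj₁ (proj₂ trees)

  tree-nonempty : ∀ {t} → t ∈ Ts → 1 ℕ.≤ length (verts t)
  tree-nonempty t∈ = proj₁ (All.lookup (proj₂ (proj₂ trees)) t∈)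

  tree-edges-inside : ∀ {t} → t ∈ Ts → All (λ e → (proj₁ e ∈ verts t) × (proj₂ e ∈ verts t)) (tedges t)
  tree-edges-inside t∈ = proj₁ (proj₂ (All.lookup (proj₂ (proj₂ trees)) t∈))

  Unique-verts : Unique (concatMap verts Ts)
  Unique-verts = Unique-resp-↭ (↭-sym verts↭) (allFin⁺ n)

  covers : Covers Ts
  covers v = ∈-concatMap⁻ verts (∈-resp-↭ (↭-sym verts↭) (∈-allFin v))

  sameTree-in : ∀ {t a b} → t ∈ Ts → a ∈ verts t → SameTree Ts a b → b ∈ verts t
  sameTree-in t∈ a∈t same with find same
  ... | t′ , t′∈ , a∈t′ , b∈t′ with Unique-concatMap⇒≡ verts Unique-verts t∈ t′∈ a∈t a∈t′
  ... | refl = b∈t′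

  tree-saturated : ∀ {t} → t ∈ Ts → Saturated Ts (verts t)
  tree-saturated t∈ same a∈t = sameTree-in t∈ a∈t same

  sameTree-sym : ∀ {a b} → SameTree Ts a b → SameTree Ts b a
  sameTree-sym = Any.map (λ (a∈ , b∈) → b∈ , a∈)

  sameTree-trans : ∀ {a b c} → SameTree Ts a b → SameTree Ts b c → SameTree Ts a c
  sameTree-trans ab bc with find ab
  ... | t , t∈ , a∈t , b∈t = lose t∈ (a∈t , sameTree-in t∈ b∈t bc)

  Fstar-sameTree : ∀ {a b} → (a , b) ∈ Fstar d⋆ T̂ → SameTree Ts a b
  Fstar-sameTree ab∈ with find (∈-concatMap⁻ tedges (∈-resp-↭ (↭-sym edges↭) ab∈))
  ... | t , t∈ , ab∈t = lose t∈ (All.lookup (tree-edges-inside t∈) ab∈t)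

  uncontracted-sameTree : ∀ {ê a b} → ê ∈ T̂ → (a , b) ∈ uncontract d⋆ ê → SameTree Ts a b
  uncontracted-sameTree ê∈ ab∈ = Fstar-sameTree (∈-concatMap⁺ (uncontract d⋆) (lose ê∈ ab∈))

  T̂-sameTree : ∀ {a b} → UEdge T̂ (just a) (just b) → SameTree Ts a b
  T̂-sameTree (inj₁ ab∈) = uncontracted-sameTree ab∈ (here refl)
  T̂-sameTree (inj₂ ba∈) = sameTree-sym (uncontracted-sameTree ba∈ (here refl))

  T̂-depotTree : ∀ {a} → UEdge T̂ (just a) nothing → SameTree Ts (d⋆ a) a
  T̂-depotTree (inj₁ ê∈) = uncontracted-sameTree ê∈ (here refl)
  T̂-depotTree (inj₂ ê∈) = uncontracted-sameTree ê∈ (here refl)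

  T̂-spanning : SpanningTree (contractedVerts D) T̂
  T̂-spanning = proj₁ mst

  T̂-connected : ∀ {a b} → a ∈ contractedVerts D → b ∈ contractedVerts D → Conn T̂ a b
  T̂-connected = proj₁ (proj₂ (proj₂ (proj₂ T̂-spanning)))

  just∈contracted : ∀ {v} → ¬ Depot v → just v ∈ contractedVerts D
  just∈contracted {v} ¬depot = there (∈-map⁺ just (∈-filter⁺ (∁? depot?) (∈-allFin v) ¬depot))

  just∈contracted⇒¬depot : ∀ {v} → just v ∈ contractedVerts D → ¬ Depot v
  just∈contracted⇒¬depot (there v∈) with ∈-map⁻ just v∈
  ... | _ , u∈ , refl = proj₂ (∈-filter⁻ (∁? depot?) {xs = allFin n} u∈)

  reaches-depot : ∀ {v} → Conn T̂ (just v) nothing → ∃[ d ] (Depot d × SameTree Ts v d)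
  reaches-depot {v} (step {b = nothing} e _) = d⋆ v , proj₁ (argmin v) , sameTree-sym (T̂-depotTree e)
  reaches-depot     (step {b = just _}  e p) with reaches-depot p
  ... | d , depot , same = d , depot , sameTree-trans (T̂-sameTree e) same

  tree-has-depot : ∀ {t} → t ∈ Ts → ∃[ d ] (Depot d × d ∈ verts t)
  tree-has-depot t∈ with nonempty⇒∈ (tree-nonempty t∈)
  ... | v , v∈t with depot? v
  ...   | yes depot = v , depot , v∈t
  ...   | no ¬depot with reaches-depot (T̂-connected (just∈contracted ¬depot) (here refl))
  ...     | d , depot , same = d , depot , sameTree-in t∈ v∈t same

  -- Bad-tree elimination

  RootedIn : List (Fin n) → List (Fin n) → Set
  RootedIn X c = Any (λ v → Depot v × v ∈ X) c

  rootedIn? : ∀ X → Decidable (RootedIn X)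
  rootedIn? X c = any? (λ v → depot? v ×-dec v ∈? X) c

  Meets : List (Fin n) → List (Fin n) → Set
  Meets X ys = Any (_∈ X) ys

  meets? : ∀ X → Decidable (Meets X)
  meets? X ys = any? (_∈? X) ys

  meetsTree? : ∀ X → Decidable (λ (t : Tree) → Meets X (verts t))
  meetsTree? X t = meets? X (verts t)

  treesW : List (Fin n) → ℚ
  treesW X = ∑ (treeW w) (filter (meetsTree? X) Ts)

  rootedMaxW : List (Fin n) → ℚ
  rootedMaxW X = ∑ maxW (filter (rootedIn? X) Cs)

  Φ : List (Fin n) → ℚ
  Φ X = treesW X + rootedMaxW X

  Φ-nonNeg : ∀ X → 0ℚ ≤ Φ X
  Φ-nonNeg X =
    +-nonNeg (∑-nonNeg treeW-nonNeg (filter (meetsTree? X) Ts)) (∑-nonNeg maxW-nonNeg (filter (rootedIn? X) Cs))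

  Φ-superadditive : ∀ {X Y} → Saturated Ts X → (∀ {v} → v ∈ X → v ∉ Y) → Φ X + Φ Y ≤ Φ (X ++ Y)
  Φ-superadditive {X} {Y} X-sat disjoint = begin
    Φ X + Φ Y
      ≡⟨ solve 4 (λ a b c d → (a :+ b) :+ (c :+ d) := (a :+ c) :+ (b :+ d))
        refl (treesW X) (rootedMaxW X) (treesW Y) (rootedMaxW Y) ⟩
    (treesW X + treesW Y) + (rootedMaxW X + rootedMaxW Y)
      ≤⟨ +-mono-≤ treesW-sup rootedMaxW-sup ⟩
    Φ (X ++ Y) ∎
    where
    open ℚ.≤-Reasoning
    trees-disjoint : ∀ {t} → t ∈ Ts → Meets X (verts t) → ¬ Meets Y (verts t)
    trees-disjoint t∈ meetsX meetsY with find meetsX | find meetsY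
    ... | x , x∈t , x∈X | y , y∈t , y∈Y = disjoint (X-sat (lose t∈ (x∈t , y∈t)) x∈X) y∈Y
    treesW-sup = ∑-filter-∪ treeW-nonNeg (meetsTree? X) (meetsTree? Y) (meetsTree? (X ++ Y))
              (Any.map ∈-++⁺ˡ) (Any.map (∈-++⁺ʳ X)) (All.tabulate trees-disjoint)
    cycles-disjoint : ∀ {c} → c ∈ Cs → RootedIn X c → ¬ RootedIn Y c
    cycles-disjoint c∈ rootedX rootedY with find rootedX | find rootedY
    ... | x , x∈c , x-depot , x∈X | y , y∈c , y-depot , y∈Y with depot-unique c∈ x∈c y∈c x-depot y-depot
    ...   | refl = disjoint x∈X y∈Y
    rootedMaxW-sup = ∑-filter-∪ maxW-nonNeg (rootedIn? X) (rootedIn? Y) (rootedIn? (X ++ Y))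
               (Any.map (λ (depot , x∈X) → depot , ∈-++⁺ˡ x∈X))
               (Any.map (λ (depot , y∈Y) → depot , ∈-++⁺ʳ X y∈Y))
               (All.tabulate cycles-disjoint)

  Φ-concat : ∀ Ns → All (λ T → Saturated Ts (verts T)) Ns → Unique (concatMap verts Ns) →
             ∑ (λ T → Φ (verts T)) Ns ≤ Φ (concatMap verts Ns)
  Φ-concat []       []             _ = Φ-nonNeg []
  Φ-concat (T ∷ Ns) (T-sat ∷ sats) u = begin
    Φ (verts T) + ∑ (λ T → Φ (verts T)) Ns
      ≤⟨ +-monoʳ-≤ (Φ (verts T)) (Φ-concat Ns sats (Unique-++⁻ʳ (verts T) u)) ⟩
    Φ (verts T) + Φ (concatMap verts Ns)
      ≤⟨ Φ-superadditive T-sat (Unique-++⇒disjoint (verts T) u) ⟩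
    Φ (verts T ++ concatMap verts Ns) ∎
    where open ℚ.≤-Reasoning

  Charged : Tree → Set
  Charged T = Saturated Ts (verts T)
            × ∃[ c ] (c ∈ Cs × RootedIn (verts T) c × (treeW w T + maxW c ≤ Φ (verts T)))

  initial-charged : ∀ {t} → t ∈ Ts → Charged t
  initial-charged {t} t∈ with tree-has-depot t∈
  ... | d , depot , d∈t with find (cycles-cover d)
  ... | c , c∈ , d∈c = tree-saturated t∈ , c , c∈ , rooted , +-mono-≤ tree≤ max≤
    where
    rooted = lose d∈c (depot , d∈t)
    tree≤ = ∈⇒≤∑ treeW-nonNeg (∈-filter⁺ (meetsTree? (verts t)) t∈ (lose d∈t d∈t))
    max≤  = ∈⇒≤∑ maxW-nonNeg (∈-filter⁺ (rootedIn? (verts t)) c∈ rooted)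

  cycle-crosses : ∀ {X c} → Meets X c → ¬ All (_∈ X) c → ∃[ a ] ∃[ b ] (a ∈ X × b ∉ X × w a b ≤ maxW c)
  cycle-crosses {X} {c} meets ¬inside with find meets | find (¬All⇒Any¬ (_∈? X) c ¬inside)
  ... | x , x∈c , x∈X | y , y∈c , y∉X with consec-crosses (_∈? X) x∈c x∈X y∈c y∉X
  ...   | a , b , ab∈ , inj₁ (a∈X , b∉X) = a , b , a∈X , b∉X , maxEdgeW-≥ w (consec⊆cycleEdges ab∈)
  ...   | a , b , ab∈ , inj₂ (a∉X , b∈X) =
    b , a , b∈X , a∉X , ≤-trans (≤-reflexive (w-sym b a)) (maxEdgeW-≥ w (consec⊆cycleEdges ab∈))

  lightest-leaving-≤-maxW : ∀ {X c v v′} → Saturated Ts X → Meets X c → ¬ All (_∈ X) c →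
                            (∀ a b → UEdge E† a b → a ∈ X → b ∉ X → w v v′ ≤ w a b) → w v v′ ≤ maxW c
  lightest-leaving-≤-maxW X-sat meets ¬inside lightest with cycle-crosses meets ¬inside
  ... | a , b , a∈X , b∉X , ab≤max with dagger-cut w w-sym dagger covers X-sat a∈X b∉X
  ...   | x , y , xy∈E† , x∈X , y∉X , xy≤ab = ≤-trans (lightest x y xy∈E† x∈X y∉X) (≤-trans xy≤ab ab≤max)

  merge-charged : ∀ {Tb Tc v v′} → Charged Tb → Charged Tc → Bad Tb → (∀ {x} → x ∈ verts Tb → x ∉ verts Tc) →
                  (∀ a b → UEdge E† a b → a ∈ verts Tb → b ∉ verts Tb → w v v′ ≤ w a b) →
                  Charged (merge Tb Tc (v , v′))
  merge-charged {Tb} {Tc} {v} {v′}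
                (Tb-sat , cb , cb∈ , cb-rooted , Tb-bound) (Tc-sat , cc , cc∈ , cc-rooted , Tc-bound)
                (_ , ¬cycle) disjoint lightest =
    merged-sat , cc , cc∈ , Any.map (λ (depot , x∈) → depot , ∈-++⁺ʳ (verts Tb) x∈) cc-rooted , bound
    where
    tb = treeW w Tb
    tc = treeW w Tc
    vv′≤maxW : w v v′ ≤ maxW cb
    vv′≤maxW =
      lightest-leaving-≤-maxW Tb-sat (Any.map proj₂ cb-rooted) (λ inside → ¬cycle (lose cb∈ inside)) lightest
    merged-sat : Saturated Ts (verts Tb ++ verts Tc)
    merged-sat same x∈ with ∈-++⁻ (verts Tb) x∈
    ... | inj₁ x∈Tb = ∈-++⁺ˡ (Tb-sat same x∈Tb)
    ... | inj₂ x∈Tc = ∈-++⁺ʳ (verts Tb) (Tc-sat same x∈Tc)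
    bound : treeW w (merge Tb Tc (v , v′)) + maxW cc ≤ Φ (verts Tb ++ verts Tc)
    bound = begin
      w v v′ + wsum w (tedges Tb ++ tedges Tc) + maxW cc
        ≡⟨ cong (λ s → w v v′ + s + maxW cc) (wsum-++ w (tedges Tb) (tedges Tc)) ⟩
      w v v′ + (tb + tc) + maxW cc
        ≤⟨ +-monoˡ-≤ (maxW cc) (+-monoˡ-≤ (tb + tc) vv′≤maxW) ⟩
      maxW cb + (tb + tc) + maxW cc
        ≡⟨ solve 4 (λ m a b m′ → m :+ (a :+ b) :+ m′ := (a :+ m) :+ (b :+ m′))
          refl (maxW cb) tb tc (maxW cc) ⟩
      (tb + maxW cb) + (tc + maxW cc)
        ≤⟨ +-mono-≤ Tb-bound Tc-bound ⟩
      Φ (verts Tb) + Φ (verts Tc)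
        ≤⟨ Φ-superadditive Tb-sat disjoint ⟩
      Φ (verts Tb ++ verts Tc) ∎
      where open ℚ.≤-Reasoning

  charged⇒treeW≤Φ : ∀ {T} → Charged T → treeW w T ≤ Φ (verts T)
  charged⇒treeW≤Φ (_ , c , _ , _ , bound) = ≤-trans (p≤p+q (maxW-nonNeg c)) bound

  elimination-invariant : ∀ {F F′} → Elim E† F F′ → Partition F → All Charged F →
                          Partition F′ × All Charged F′ × All (λ T → ¬ Bad T) F′
  elimination-invariant (stop ¬bad) partition charged = partition , charged , ¬bad
  elimination-invariant {F} (join {Tb = Tb} {Tc} {rest' = rest′} {v = v} {v′} F↭ bad _ _ _ lightest rest↭ _ steps)
                        partition charged =
    elimination-invariant steps merged-partition (merge-step (All-resp-↭ F↭′ charged))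
    where
    F↭′ : F ↭ Tb ∷ Tc ∷ rest′
    F↭′ = ↭-trans F↭ (↭-prep Tb rest↭)
    partition′ : Partition (Tb ∷ Tc ∷ rest′)
    partition′ = ↭-trans (↭-sym (concatMap-↭ verts F↭′)) partition
    disjoint : ∀ {x} → x ∈ verts Tb → x ∉ verts Tc
    disjoint x∈Tb x∈Tc =
      Unique-++⇒disjoint (verts Tb) (Unique-resp-↭ (↭-sym partition′) (allFin⁺ n)) x∈Tb (∈-++⁺ˡ x∈Tc)
    merge-step : All Charged (Tb ∷ Tc ∷ rest′) → All Charged (merge Tb Tc (v , v′) ∷ rest′)
    merge-step (Tb-charged ∷ Tc-charged ∷ rest-charged) =
      merge-charged {Tb} {Tc} Tb-charged Tc-charged bad disjoint lightest ∷ rest-charged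
    merged-partition : Partition (merge Tb Tc (v , v′) ∷ rest′)
    merged-partition = ↭-trans (↭-reflexive (List.++-assoc (verts Tb) (verts Tc) _)) partition′

  -- Exchange against the minimum spanning tree

  OpenPath : List (Fin n) → Set
  OpenPath c = ∃[ L ] ∃[ d ] ∃[ R ]
    ((c ↭ L ++ d ∷ R) × Depot d × (pathW w (L ++ d ∷ R) + maxW c ≤ cycleW w c))

  open-path : ∀ {c} → c ∈ Cs → OpenPath c
  open-path {c} c∈ with cycle-open-at-heaviest w w-nonNeg c
  ... | p , c↭p , path+max≤ with nonempty⇒∈ (ℕ.≤-reflexive (sym (proj₂ (proj₂ (All.lookup cycles-wf c∈)))))
  ...   | d , d∈depots with ∈-filter⁻ depot? {xs = c} d∈depots
  ...     | d∈c , depot with ∈-∃++ (∈-resp-↭ c↭p d∈c)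
  ...       | L , R , refl = L , d , R , c↭p , depot , path+max≤

  module Exchange (S : List (Fin n)) (S-sat : Saturated Ts S) where

    V̂ : Set
    V̂ = Maybe (Fin n)

    Ê : Set
    Ê = V̂ × V̂

    ŵ′ : V̂ → V̂ → ℚ
    ŵ′ = ŵ w d⋆

    InS : V̂ → Set
    InS nothing  = ⊥
    InS (just v) = v ∈ S

    inS? : Decidable InS
    inS? nothing  = no λ ()
    inS? (just v) = v ∈? S

    Touches : Ê → Set
    Touches e = InS (proj₁ e) ⊎ InS (proj₂ e)

    touches? : Decidable Touches
    touches? e = inS? (proj₁ e) ⊎-dec inS? (proj₂ e)

    kept : List Ê
    kept = filter (∁? touches?) T̂

    State : Set
    State = List Ê × List (Fin n)

    cost : State → ℚ
    cost (acc , _) = wsum ŵ′ acc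

    Attachable : List (Fin n) → Fin n → Set
    Attachable attached y = y ∈ S × ¬ Depot y × y ∉ attached

    attachable? : ∀ attached → Decidable (Attachable attached)
    attachable? attached y = y ∈? S ×-dec ¬? (depot? y) ×-dec ¬? (y ∈? attached)

    -- Shortcutting a walk: each vertex of S met for the first time is joined to the vertex
    -- joined before it (initially to a), so by the triangle inequality the new edges cost
    -- no more than the walk.
    attach : V̂ → List (Fin n) → State → State
    attach a []       σ                = σ
    attach a (y ∷ ys) (acc , attached) with attachable? attached y
    ... | yes _ = attach (just y) ys ((just y , a) ∷ acc , y ∷ attached)
    ... | no  _ = attach a ys (acc , attached)

    AnchoredAt : V̂ → Fin n → Set
    AnchoredAt a z = (a ≡ nothing × Depot z) ⊎ (a ≡ just z)

    anchor-cost : ∀ {a z} y → AnchoredAt a z → ŵ′ (just y) a ≤ w z y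
    anchor-cost y (inj₁ (refl , depot)) = proj₂ (argmin y) _ depot
    anchor-cost y (inj₂ refl)           = ≤-reflexive (w-sym y _)

    attach-cost : ∀ {a z} → AnchoredAt a z → ∀ x ys σ → cost (attach a ys σ) ≤ cost σ + (w z x + pathW w (x ∷ ys))
    attach-cost {z = z} anchored x []       σ = p≤p+q (+-nonNeg (w-nonNeg z x) ≤-refl)
    attach-cost {a} {z} anchored x (y ∷ ys) (acc , attached) with attachable? attached y
    ... | yes _ = begin
      cost (attach (just y) ys ((just y , a) ∷ acc , y ∷ attached))
        ≤⟨ attach-cost (inj₂ refl) y ys _ ⟩
      ŵ′ (just y) a + C + (w y y + P)
        ≡⟨ cong (λ d → ŵ′ (just y) a + C + (d + P)) (w-zero y) ⟩
      ŵ′ (just y) a + C + (0ℚ + P)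
        ≡⟨ solve 3 (λ h c p → h :+ c :+ (con 0ℚ :+ p) := c :+ (h :+ p)) refl (ŵ′ (just y) a) C P ⟩
      C + (ŵ′ (just y) a + P)
        ≤⟨ +-monoʳ-≤ C (+-monoˡ-≤ P (≤-trans (anchor-cost y anchored) (w-tri z x y))) ⟩
      C + (w z x + w x y + P)
        ≡⟨ cong (C +_) (ℚ.+-assoc (w z x) (w x y) P) ⟩
      C + (w z x + (w x y + P)) ∎
      where
      open ℚ.≤-Reasoning
      C = wsum ŵ′ acc
      P = pathW w (y ∷ ys)
    ... | no _ = begin
      cost (attach a ys (acc , attached))  ≤⟨ attach-cost anchored y ys _ ⟩
      C + (w z y + P)                      ≤⟨ +-monoʳ-≤ C (+-monoˡ-≤ P (w-tri z x y)) ⟩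
      C + (w z x + w x y + P)              ≡⟨ cong (C +_) (ℚ.+-assoc (w z x) (w x y) P) ⟩
      C + (w z x + (w x y + P))            ∎
      where
      open ℚ.≤-Reasoning
      C = wsum ŵ′ acc
      P = pathW w (y ∷ ys)

    attach-idle : ∀ a ys σ → ¬ Meets S ys → attach a ys σ ≡ σ
    attach-idle a []       σ                _      = refl
    attach-idle a (y ∷ ys) (acc , attached) ¬meets with attachable? attached y
    ... | yes (y∈S , _) = ⊥-elim (¬meets (here y∈S))
    ... | no _          = attach-idle a ys (acc , attached) (λ meets → ¬meets (there meets))

    attach-grows : ∀ a ys σ → proj₂ σ ⊆ᴸ proj₂ (attach a ys σ)
    attach-grows a []       σ                = λ z∈ → z∈
    attach-grows a (y ∷ ys) (acc , attached) with attachable? attached y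
    ... | yes _ = λ z∈ → attach-grows (just y) ys _ (there z∈)
    ... | no  _ = attach-grows a ys (acc , attached)

    attach-covers : ∀ a ys σ {y} → y ∈ ys → y ∈ S → ¬ Depot y → y ∈ proj₂ (attach a ys σ)
    attach-covers a (y ∷ ys) (acc , attached) y∈ y∈S ¬depot with attachable? attached y | y∈
    ... | yes _      | here refl = attach-grows (just y) ys _ (here refl)
    ... | no ¬attach | here refl with y ∈? attached
    ...   | yes y∈attached = attach-grows a ys (acc , attached) y∈attached
    ...   | no y∉attached  = ⊥-elim (¬attach (y∈S , ¬depot , y∉attached))
    attach-covers a (y ∷ ys) (acc , attached) y∈ y∈S ¬depot | yes _ | there y∈ys =
      attach-covers (just y) ys _ y∈ys y∈S ¬depot
    attach-covers a (y ∷ ys) (acc , attached) y∈ y∈S ¬depot | no _  | there y∈ys =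
      attach-covers a ys _ y∈ys y∈S ¬depot

    -- Edges only ever join settled vertices, so every attachment adds a new leaf.
    Settled : List (Fin n) → V̂ → Set
    Settled attached nothing  = ⊤
    Settled attached (just z) = z ∉ S ⊎ z ∈ attached

    Hooked : List (Fin n) → V̂ → Set
    Hooked attached nothing  = ⊤
    Hooked attached (just z) = z ∈ attached

    settled-mono : ∀ {att att′} → att ⊆ᴸ att′ → ∀ x → Settled att x → Settled att′ x
    settled-mono sub nothing  _          = tt
    settled-mono sub (just z) (inj₁ z∉S) = inj₁ z∉S
    settled-mono sub (just z) (inj₂ z∈)  = inj₂ (sub z∈)

    record PartialTree (acc : List Ê) (attached : List (Fin n)) : Set where
      field
        proper     : All (λ e → (proj₁ e ≢ proj₂ e) × (proj₁ e ∈ contractedVerts D)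
                                × (proj₂ e ∈ contractedVerts D)) acc
        unique     : Unique acc
        no-reverse : ∀ {p q} → (p , q) ∈ acc → (q , p) ∉ acc
        acyclic    : ¬ HasCycle acc
        settled    : All (λ e → Settled attached (proj₁ e) × Settled attached (proj₂ e)) acc
        reach-root : ∀ {z} → z ∈ attached → Conn acc (just z) nothing
        non-depot  : ∀ {z} → z ∈ attached → ¬ Depot z
        keeps      : kept ⊆ᴸ acc
    open PartialTree

    Valid : State → Set
    Valid (acc , attached) = PartialTree acc attached

    attach-one : ∀ {acc attached a y} → PartialTree acc attached → Hooked attached a → Attachable attached y →
                 PartialTree ((just y , a) ∷ acc) (y ∷ attached)
    attach-one {acc} {attached} {a} {y} T hooked (y∈S , ¬depot , y∉) = record
      { proper     = (y≢a a hooked , just∈contracted ¬depot , anchor∈ a hooked) ∷ proper T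
      ; unique     = pendant-unique avoids (unique T)
      ; no-reverse = pendant-noReverse avoids (y≢a a hooked) (no-reverse T)
      ; acyclic    = pendant-acyclic avoids (Maybe.≡-dec Fin._≟_) (y≢a a hooked) (acyclic T)
      ; settled    = (inj₂ (here refl) , settled-mono there a (hooked⇒settled a hooked))
                     ∷ All.map (λ (p , q) → settled-mono there _ p , settled-mono there _ q) (settled T)
      ; reach-root = λ { (here refl) → step (inj₁ (here refl)) (anchor-reaches a hooked)
                       ; (there z∈)  → Conn-mono there (reach-root T z∈) }
      ; non-depot  = λ { (here refl) → ¬depot ; (there z∈) → non-depot T z∈ }
      ; keeps      = λ e∈ → there (keeps T e∈)
      }
      where
      y≢a : ∀ a → Hooked attached a → just y ≢ a
      y≢a (just z) z∈ refl = y∉ z∈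
      anchor∈ : ∀ a → Hooked attached a → a ∈ contractedVerts D
      anchor∈ nothing  _  = here refl
      anchor∈ (just z) z∈ = just∈contracted (non-depot T z∈)
      hooked⇒settled : ∀ a → Hooked attached a → Settled attached a
      hooked⇒settled nothing  _  = tt
      hooked⇒settled (just z) z∈ = inj₂ z∈
      anchor-reaches : ∀ a → Hooked attached a → Conn ((just y , a) ∷ acc) a nothing
      anchor-reaches nothing  _  = here
      anchor-reaches (just z) z∈ = Conn-mono there (reach-root T z∈)
      ¬settled-y : ∀ x → Settled attached x → x ≢ just y
      ¬settled-y (just z) (inj₁ z∉S) refl = z∉S y∈S
      ¬settled-y (just z) (inj₂ z∈)  refl = y∉ z∈
      avoids : Avoids (just y) acc
      avoids pq∈ with All.lookup (settled T) pq∈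
      ... | p-settled , q-settled = ¬settled-y _ p-settled , ¬settled-y _ q-settled

    attach-valid : ∀ a ys σ → Valid σ → Hooked (proj₂ σ) a → Valid (attach a ys σ)
    attach-valid a []       σ                valid hooked = valid
    attach-valid a (y ∷ ys) (acc , attached) valid hooked with attachable? attached y
    ... | yes attachable = attach-valid (just y) ys _ (attach-one valid hooked attachable) (here refl)
    ... | no  _          = attach-valid a ys (acc , attached) valid hooked

    attach-cost-from-depot : ∀ {d} → Depot d → ∀ ys σ → cost (attach nothing ys σ) ≤ cost σ + pathW w (d ∷ ys)
    attach-cost-from-depot {d} depot ys σ = ≤-trans (attach-cost (inj₁ (refl , depot)) d ys σ)
      (≤-reflexive (cong (cost σ +_) (Eq.trans (cong (_+ pathW w (d ∷ ys)) (w-zero d)) (ℚ.+-identityˡ _))))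

    -- Both halves of the opened cycle are walked away from its depot, starting from d̂.
    attachCycle : ∀ {c} → OpenPath c → State → State
    attachCycle (L , d , R , _) σ = attach nothing (reverse L) (attach nothing R σ)

    attachCycle-cost : ∀ {c} (path : OpenPath c) σ → cost (attachCycle path σ) + maxW c ≤ cost σ + cycleW w c
    attachCycle-cost {c} (L , d , R , _ , depot , path+max≤) σ = begin
      cost (attach nothing (reverse L) σ′) + maxW c
        ≤⟨ +-monoˡ-≤ (maxW c) (attach-cost-from-depot depot (reverse L) σ′) ⟩
      cost σ′ + pathW w (d ∷ reverse L) + maxW c
        ≤⟨ +-monoˡ-≤ (maxW c) (+-monoˡ-≤ _ (attach-cost-from-depot depot R σ)) ⟩
      cost σ + Pᴿ + pathW w (d ∷ reverse L) + maxW c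
        ≡⟨ cong (λ p → cost σ + Pᴿ + p + maxW c) reversed ⟩
      cost σ + Pᴿ + Pᴸ + maxW c
        ≡⟨ solve 4 (λ a r l m → a :+ r :+ l :+ m := a :+ (l :+ r :+ m)) refl (cost σ) Pᴿ Pᴸ (maxW c) ⟩
      cost σ + (Pᴸ + Pᴿ + maxW c)
        ≡⟨ cong (λ p → cost σ + (p + maxW c)) (pathW-split w L d R) ⟨
      cost σ + (pathW w (L ++ d ∷ R) + maxW c)
        ≤⟨ +-monoʳ-≤ (cost σ) path+max≤ ⟩
      cost σ + cycleW w c ∎
      where
      open ℚ.≤-Reasoning
      σ′ = attach nothing R σ
      Pᴸ = pathW w (L ∷ʳ d)
      Pᴿ = pathW w (d ∷ R)
      reversed : pathW w (d ∷ reverse L) ≡ Pᴸ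
      reversed = Eq.trans (cong (pathW w) (sym (List.reverse-++ L [ d ]))) (pathW-reverse w w-sym (L ∷ʳ d))

    attachCycle-idle : ∀ {c} (path : OpenPath c) σ → ¬ Meets S c → attachCycle path σ ≡ σ
    attachCycle-idle (L , d , R , c↭ , _) σ ¬meets = begin
      attach nothing (reverse L) (attach nothing R σ)
        ≡⟨ cong (attach nothing (reverse L)) (attach-idle nothing R σ (¬meets ∘ from-R)) ⟩
      attach nothing (reverse L) σ
        ≡⟨ attach-idle nothing (reverse L) σ (¬meets ∘ from-L) ⟩
      σ ∎
      where
      open Eq.≡-Reasoning
      from-R : Meets S R → Meets S _
      from-R meets = Any-resp-↭ (↭-sym c↭) (AnyP.++⁺ʳ L (there meets))
      from-L : Meets S (reverse L) → Meets S _
      from-L meets = Any-resp-↭ (↭-sym c↭) (AnyP.++⁺ˡ (Any-resp-↭ (↭-reverse L) meets))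

    attachCycle-valid : ∀ {c} (path : OpenPath c) σ → Valid σ → Valid (attachCycle path σ)
    attachCycle-valid (L , d , R , _) σ valid =
      attach-valid nothing (reverse L) _ (attach-valid nothing R σ valid tt) tt

    attachCycle-grows : ∀ {c} (path : OpenPath c) σ → proj₂ σ ⊆ᴸ proj₂ (attachCycle path σ)
    attachCycle-grows (L , d , R , _) σ = attach-grows nothing (reverse L) _ ∘ attach-grows nothing R σ

    attachCycle-covers : ∀ {c} (path : OpenPath c) σ {y} → y ∈ c → y ∈ S → ¬ Depot y →
                         y ∈ proj₂ (attachCycle path σ)
    attachCycle-covers (L , d , R , c↭ , depot , _) σ y∈c y∈S ¬depot with ∈-++⁻ L (∈-resp-↭ c↭ y∈c)
    ... | inj₁ y∈L          = attach-covers nothing (reverse L) _ (∈-resp-↭ (↭-sym (↭-reverse L)) y∈L) y∈S ¬depot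
    ... | inj₂ (here refl)  = ⊥-elim (¬depot depot)
    ... | inj₂ (there y∈R)  = attach-grows nothing (reverse L) _ (attach-covers nothing R σ y∈R y∈S ¬depot)

    attachAll : ∀ {cs} → All OpenPath cs → State → State
    attachAll []             σ = σ
    attachAll (path ∷ paths) σ = attachAll paths (attachCycle path σ)

    attachAll-cost : ∀ {cs} (paths : All OpenPath cs) σ →
                     cost (attachAll paths σ) + ∑ maxW (filter (meets? S) cs)
                     ≤ cost σ + ∑ (cycleW w) (filter (meets? S) cs)
    attachAll-cost []                       σ = ≤-refl
    attachAll-cost {c ∷ cs} (path ∷ paths) σ with meets? S c
    ... | no ¬meets rewrite attachCycle-idle path σ ¬meets = attachAll-cost paths σ
    ... | yes _ = begin
      cost (attachAll paths σ′) + (maxW c + M)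
        ≡⟨ solve 3 (λ a m M → a :+ (m :+ M) := a :+ M :+ m) refl (cost (attachAll paths σ′)) (maxW c) M ⟩
      cost (attachAll paths σ′) + M + maxW c
        ≤⟨ +-monoˡ-≤ (maxW c) (attachAll-cost paths σ′) ⟩
      cost σ′ + W + maxW c
        ≡⟨ solve 3 (λ a W m → a :+ W :+ m := a :+ m :+ W) refl (cost σ′) W (maxW c) ⟩
      cost σ′ + maxW c + W
        ≤⟨ +-monoˡ-≤ W (attachCycle-cost path σ) ⟩
      cost σ + cycleW w c + W
        ≡⟨ ℚ.+-assoc (cost σ) (cycleW w c) W ⟩
      cost σ + (cycleW w c + W) ∎
      where
      open ℚ.≤-Reasoning
      σ′ = attachCycle path σ
      M = ∑ maxW (filter (meets? S) cs)
      W = ∑ (cycleW w) (filter (meets? S) cs)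

    attachAll-valid : ∀ {cs} (paths : All OpenPath cs) σ → Valid σ → Valid (attachAll paths σ)
    attachAll-valid []             σ valid = valid
    attachAll-valid (path ∷ paths) σ valid = attachAll-valid paths _ (attachCycle-valid path σ valid)

    attachAll-grows : ∀ {cs} (paths : All OpenPath cs) σ → proj₂ σ ⊆ᴸ proj₂ (attachAll paths σ)
    attachAll-grows []             σ = λ z∈ → z∈
    attachAll-grows (path ∷ paths) σ = attachAll-grows paths _ ∘ attachCycle-grows path σ

    attachAll-covers : ∀ {cs} (paths : All OpenPath cs) σ {c y} → c ∈ cs → y ∈ c → y ∈ S → ¬ Depot y →
                       y ∈ proj₂ (attachAll paths σ)
    attachAll-covers (path ∷ paths) σ (here refl) y∈c y∈S ¬depot =
      attachAll-grows paths _ (attachCycle-covers path σ y∈c y∈S ¬depot)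
    attachAll-covers (path ∷ paths) σ (there c∈)  y∈c y∈S ¬depot = attachAll-covers paths _ c∈ y∈c y∈S ¬depot

    kept⊆T̂ : kept ⊆ᴸ T̂
    kept⊆T̂ e∈ = proj₁ (∈-filter⁻ (∁? touches?) {xs = T̂} e∈)

    initial-valid : Valid (kept , [])
    initial-valid = record
      { proper     = All.tabulate (λ e∈ → All.lookup (proj₁ T̂-spanning) (kept⊆T̂ e∈))
      ; unique     = Unique-filter⁺ (∁? touches?) (proj₁ (proj₂ T̂-spanning))
      ; no-reverse = λ pq∈ qp∈ → proj₁ (proj₂ (proj₂ T̂-spanning)) (kept⊆T̂ pq∈) (kept⊆T̂ qp∈)
      ; acyclic    = proj₂ (proj₂ (proj₂ (proj₂ T̂-spanning))) ∘ HasCycle-mono kept⊆T̂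
      ; settled    = All.tabulate (λ e∈ → untouched-settled (proj₂ (∈-filter⁻ (∁? touches?) {xs = T̂} e∈)))
      ; reach-root = λ ()
      ; non-depot  = λ ()
      ; keeps      = λ e∈ → e∈
      }
      where
      outside-settled : ∀ x → ¬ InS x → Settled [] x
      outside-settled nothing  _    = tt
      outside-settled (just z) z∉S = inj₁ z∉S
      untouched-settled : ∀ {e} → ¬ Touches e → Settled [] (proj₁ e) × Settled [] (proj₂ e)
      untouched-settled ¬touches = outside-settled _ (¬touches ∘ inj₁) , outside-settled _ (¬touches ∘ inj₂)

    kept-edge : ∀ {a b} → ¬ InS a → ¬ InS b → UEdge T̂ a b → UEdge kept a b
    kept-edge a∉S b∉S (inj₁ ab∈) = inj₁ (∈-filter⁺ (∁? touches?) ab∈ (either a∉S b∉S))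
    kept-edge a∉S b∉S (inj₂ ba∈) = inj₂ (∈-filter⁺ (∁? touches?) ba∈ (either b∉S a∉S))

    -- Since S is a union of trees of F*, the path of T̂ from a vertex outside S to d̂ avoids S.
    kept-reach : ∀ {v} → v ∉ S → Conn T̂ (just v) nothing → Conn kept (just v) nothing
    kept-reach v∉S (step {b = nothing} e _) = step (kept-edge v∉S (λ ()) e) here
    kept-reach v∉S (step {b = just x}  e p) = step (kept-edge v∉S x∉S e) (kept-reach x∉S p)
      where
      x∉S : x ∉ S
      x∉S x∈S = v∉S (S-sat (sameTree-sym (T̂-sameTree e)) x∈S)

    openPaths : All OpenPath Cs
    openPaths = All.tabulate open-path

    competitor : State
    competitor = attachAll openPaths (kept , [])

    competitor-valid : Valid competitor
    competitor-valid = attachAll-valid openPaths (kept , []) initial-valid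

    competitor-reach : ∀ {x} → x ∈ contractedVerts D → Conn (proj₁ competitor) x nothing
    competitor-reach {nothing} _  = here
    competitor-reach {just v}  v∈ with v ∈? S
    ... | yes v∈S with find (cycles-cover v)
    ...   | c , c∈ , v∈c =
      reach-root competitor-valid (attachAll-covers openPaths (kept , []) c∈ v∈c v∈S (just∈contracted⇒¬depot v∈))
    competitor-reach {just v}  v∈ | no v∉S =
      Conn-mono (keeps competitor-valid) (kept-reach v∉S (T̂-connected v∈ (here refl)))

    competitor-spanning : SpanningTree (contractedVerts D) (proj₁ competitor)
    competitor-spanning =
      proper competitor-valid , unique competitor-valid , no-reverse competitor-valid ,
      (λ a∈ b∈ → Conn-trans (competitor-reach a∈) (Conn-sym (competitor-reach b∈))) ,
      acyclic competitor-valid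

    touching : List Ê
    touching = filter touches? T̂

    touching+maxW≤cycleW : wsum ŵ′ touching + ∑ maxW (filter (meets? S) Cs) ≤ ∑ (cycleW w) (filter (meets? S) Cs)
    touching+maxW≤cycleW = +-cancelˡ-≤ (wsum ŵ′ kept) (begin
      wsum ŵ′ kept + (wsum ŵ′ touching + M)
        ≡⟨ solve 3 (λ k t m → k :+ (t :+ m) := t :+ k :+ m) refl (wsum ŵ′ kept) (wsum ŵ′ touching) M ⟩
      wsum ŵ′ touching + wsum ŵ′ kept + M
        ≡⟨ cong (_+ M) (wsum-partition ŵ′ touches? T̂) ⟨
      wsum ŵ′ T̂ + M
        ≤⟨ +-monoˡ-≤ M (proj₂ mst (proj₁ competitor) competitor-spanning) ⟩
      cost competitor + M
        ≤⟨ attachAll-cost openPaths (kept , []) ⟩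
      wsum ŵ′ kept + ∑ (cycleW w) (filter (meets? S) Cs)  ∎)
      where
      open ℚ.≤-Reasoning
      M = ∑ maxW (filter (meets? S) Cs)

    EndsInS : Edge → Set
    EndsInS e = proj₂ e ∈ S

    endsInS? : Decidable EndsInS
    endsInS? e = proj₂ e ∈? S

    ŵ-nonNeg : ∀ x y → 0ℚ ≤ ŵ′ x y
    ŵ-nonNeg (just u) (just v) = w-nonNeg u v
    ŵ-nonNeg (just v) nothing  = w-nonNeg (d⋆ v) v
    ŵ-nonNeg nothing  (just v) = w-nonNeg (d⋆ v) v
    ŵ-nonNeg nothing  nothing  = ≤-refl

    single-endsInS≤touching : ∀ ê e → uncurry w e ≡ uncurry ŵ′ ê → (EndsInS e → Touches ê) →
                        wsum w (filter endsInS? [ e ]) ≤ wsum ŵ′ (filter touches? [ ê ])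
    single-endsInS≤touching ê e same-weight ends⇒touches = by-cases (endsInS? e)
      where
      open ℚ.≤-Reasoning
      by-cases : Dec (EndsInS e) → wsum w (filter endsInS? [ e ]) ≤ wsum ŵ′ (filter touches? [ ê ])
      by-cases (no ¬ends) = begin
        wsum w (filter endsInS? [ e ])   ≡⟨ cong (wsum w) (List.filter-reject endsInS? ¬ends) ⟩
        0ℚ                               ≤⟨ wsum-nonNeg ŵ′ ŵ-nonNeg (filter touches? [ ê ]) ⟩
        wsum ŵ′ (filter touches? [ ê ])  ∎
      by-cases (yes ends) = begin
        wsum w (filter endsInS? [ e ])   ≡⟨ cong (wsum w) (List.filter-accept endsInS? ends) ⟩
        uncurry w e + 0ℚ                 ≡⟨ cong (_+ 0ℚ) {uncurry w e} {uncurry ŵ′ ê} same-weight ⟩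
        uncurry ŵ′ ê + 0ℚ                ≡⟨ cong (wsum ŵ′) (List.filter-accept touches? (ends⇒touches ends)) ⟨
        wsum ŵ′ (filter touches? [ ê ])  ∎

    uncontract-endsInS≤touching : ∀ ê → wsum w (filter endsInS? (uncontract d⋆ ê)) ≤ wsum ŵ′ (filter touches? [ ê ])
    uncontract-endsInS≤touching (just u  , just v)  = single-endsInS≤touching (just u , just v) (u , v) refl inj₂
    uncontract-endsInS≤touching (nothing , just v)  = single-endsInS≤touching (nothing , just v) (d⋆ v , v) refl inj₂
    uncontract-endsInS≤touching (just v  , nothing) = single-endsInS≤touching (just v , nothing) (d⋆ v , v) refl inj₁
    uncontract-endsInS≤touching (nothing , nothing) = ≤-refl

    Fstar-endsInS≤touching : ∀ ês → wsum w (filter endsInS? (Fstar d⋆ ês)) ≤ wsum ŵ′ (filter touches? ês)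
    Fstar-endsInS≤touching []       = ≤-refl
    Fstar-endsInS≤touching (ê ∷ ês) = begin
      wsum w (filter endsInS? (uncontract d⋆ ê ++ Fstar d⋆ ês))
        ≡⟨ cong (wsum w) (List.filter-++ endsInS? (uncontract d⋆ ê) _) ⟩
      wsum w (filter endsInS? (uncontract d⋆ ê) ++ filter endsInS? (Fstar d⋆ ês))
        ≡⟨ wsum-++ w (filter endsInS? (uncontract d⋆ ê)) _ ⟩
      wsum w (filter endsInS? (uncontract d⋆ ê)) + wsum w (filter endsInS? (Fstar d⋆ ês))
        ≤⟨ +-mono-≤ (uncontract-endsInS≤touching ê) (Fstar-endsInS≤touching ês) ⟩
      wsum ŵ′ (filter touches? [ ê ]) + wsum ŵ′ (filter touches? ês)
        ≡⟨ wsum-++ ŵ′ (filter touches? [ ê ]) _ ⟨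
      wsum ŵ′ (filter touches? [ ê ] ++ filter touches? ês)
        ≡⟨ cong (wsum ŵ′) (List.filter-++ touches? [ ê ] ês) ⟨
      wsum ŵ′ (filter touches? (ê ∷ ês)) ∎
      where open ℚ.≤-Reasoning

    treesW≤touching : treesW S ≤ wsum ŵ′ touching
    treesW≤touching = begin
      ∑ (treeW w) (filter (meetsTree? S) Ts)
        ≤⟨ ∑-mono-≤ (All.tabulate inside) ⟩
      ∑ endW (filter (meetsTree? S) Ts)
        ≤⟨ ∑-filter-≤ (λ t → wsum-nonNeg w w-nonNeg (filter endsInS? (tedges t))) (meetsTree? S) Ts ⟩
      ∑ endW Ts
        ≡⟨ wsum-filter-concatMap w endsInS? tedges Ts ⟩
      wsum w (filter endsInS? (concatMap tedges Ts))
        ≡⟨ wsum-↭ w (filter-↭ endsInS? edges↭) ⟩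
      wsum w (filter endsInS? (Fstar d⋆ T̂))
        ≤⟨ Fstar-endsInS≤touching T̂ ⟩
      wsum ŵ′ touching ∎
      where
      open ℚ.≤-Reasoning
      endW : Tree → ℚ
      endW t = wsum w (filter endsInS? (tedges t))
      inside : ∀ {t} → t ∈ filter (meetsTree? S) Ts → treeW w t ≤ endW t
      inside t∈ with ∈-filter⁻ (meetsTree? S) {xs = Ts} t∈
      ... | t∈Ts , meets with find meets
      ...   | x , x∈t , x∈S = ≤-reflexive (cong (wsum w) (sym (List.filter-all endsInS?
              (All.map (λ (_ , b∈t) → S-sat (lose t∈Ts (x∈t , b∈t)) x∈S) (tree-edges-inside t∈Ts)))))

    treesW+maxW≤cycleW : treesW S + ∑ maxW (filter (meets? S) Cs) ≤ ∑ (cycleW w) (filter (meets? S) Cs)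
    treesW+maxW≤cycleW = ≤-trans (+-monoˡ-≤ _ treesW≤touching) touching+maxW≤cycleW

  -- Counting light trees

  meeting+light≤meeting : ∀ X Ls → All Light Ls → Unique (X ++ concatMap verts Ls) →
                          length (filter (meets? X) Cs) ℕ.+ length Ls
                          ℕ.≤ length (filter (meets? (X ++ concatMap verts Ls)) Cs)
  meeting+light≤meeting X [] [] _ = ℕ.≤-trans (ℕ.≤-reflexive (ℕ.+-identityʳ _))
    (length-filter-⊆ (meets? X) (meets? (X ++ [])) (Any.map ∈-++⁺ˡ) Cs)
  meeting+light≤meeting X (L ∷ Ls) ((_ , contains) ∷ lights) u with find contains
  ... | c , c∈ , c⊆L with nonempty⇒∈ (proj₁ (All.lookup cycles-wf c∈))
  ...   | v , v∈c = begin
    length (filter (meets? X) Cs) ℕ.+ suc (length Ls)       ≡⟨ ℕ.+-suc _ (length Ls) ⟩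
    suc (length (filter (meets? X) Cs)) ℕ.+ length Ls       ≤⟨ ℕ.+-monoˡ-≤ (length Ls) one-more ⟩
    length (filter (meets? (X ++ verts L)) Cs) ℕ.+ length Ls ≤⟨ meeting+light≤meeting (X ++ verts L) Ls lights u′ ⟩
    length (filter (meets? ((X ++ verts L) ++ rest)) Cs)    ≤⟨ length-filter-⊆ _ _ (Any.map reassoc) Cs ⟩
    length (filter (meets? (X ++ verts L ++ rest)) Cs)      ∎
    where
    open ℕ.≤-Reasoning
    rest = concatMap verts Ls
    u′ : Unique ((X ++ verts L) ++ rest)
    u′ = Eq.subst Unique (sym (List.++-assoc X (verts L) rest)) u
    reassoc : ∀ {y} → y ∈ (X ++ verts L) ++ rest → y ∈ X ++ verts L ++ rest
    reassoc = Eq.subst (_ ∈_) (List.++-assoc X (verts L) rest)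
    ¬meets : ¬ Meets X c
    ¬meets meets with find meets
    ... | y , y∈c , y∈X = Unique-++⇒disjoint X u y∈X (∈-++⁺ˡ (All.lookup c⊆L y∈c))
    one-more : suc (length (filter (meets? X) Cs)) ℕ.≤ length (filter (meets? (X ++ verts L)) Cs)
    one-more = length-filter-⊂ (meets? X) (meets? (X ++ verts L)) (Any.map ∈-++⁺ˡ) c∈
                 (lose v∈c (∈-++⁺ʳ X (All.lookup c⊆L v∈c))) ¬meets

  scaleBy-∸ : ∀ {j} → j ℕ.≤ k → scaleBy k j λ* ≡ (ℤ.+ (k ℕ.∸ j) / 1) * λ*
  scaleBy-∸ {j} j≤k = cong (λ i → (i / 1) * λ*) (Eq.trans (ℤ.m-n≡m⊖n k j) (ℤ.⊖-≥ j≤k))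

  heavy⇒¬light : ∀ {T} → Heavy T → ¬ Light T
  heavy⇒¬light heavy (lighter , _) = ℚ.<-irrefl refl (ℚ.<-≤-trans lighter heavy)

  heavyW≤scaleBy : ∀ {Fopt} → Elim E† Ts Fopt → heavyW Fopt ≤ scaleBy k (nLT Fopt) λ*
  heavyW≤scaleBy {Fopt} elim = begin
    heavyW Fopt
      ≤⟨ ∑-filter-⊆ treeW-nonNeg heavy? (∁? light?) (λ {T} → heavy⇒¬light {T}) Fopt ⟩
    ∑ (treeW w) N
      ≤⟨ ∑-mono-≤ (All.map (λ {T} → charged⇒treeW≤Φ {T}) N-charged) ⟩
    ∑ (λ T → Φ (verts T)) N
      ≤⟨ Φ-concat N (All.map proj₁ N-charged) (Unique-++⁻ˡ S unique) ⟩
    treesW S + rootedMaxW S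
      ≤⟨ +-monoʳ-≤ (treesW S) (∑-filter-⊆ maxW-nonNeg (rootedIn? S) (meets? S) (Any.map proj₂) Cs) ⟩
    treesW S + ∑ maxW (filter (meets? S) Cs)
      ≤⟨ Exchange.treesW+maxW≤cycleW S S-sat ⟩
    ∑ (cycleW w) (filter (meets? S) Cs)
      ≤⟨ ∑≤m*bound λ*-nonNeg (All-filter⁺ (meets? S) cycleW≤λ*) (ℕ.m+n≤o⇒m≤o∸n _ counted) ⟩
    (ℤ.+ (k ℕ.∸ nLT Fopt) / 1) * λ*
      ≡⟨ scaleBy-∸ {nLT Fopt} (ℕ.m+n≤o⇒n≤o _ counted) ⟨
    scaleBy k (nLT Fopt) λ* ∎
    where
    open ℚ.≤-Reasoning
    N  = filter (∁? light?) Fopt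
    Ls = filter light? Fopt
    S  = concatMap verts N
    invariant = elimination-invariant elim verts↭ (All.tabulate initial-charged)
    N-charged : All Charged N
    N-charged = All-filter⁺ (∁? light?) (proj₁ (proj₂ invariant))
    S-sat : Saturated Ts S
    S-sat = Saturated-concat N (All.map proj₁ N-charged)
    unique : Unique (S ++ concatMap verts Ls)
    unique = Unique-resp-↭ (↭-sym (↭-trans (↭-reflexive (sym (List.concatMap-++ verts N Ls)))
               (↭-trans (concatMap-↭ verts Fopt↭) (proj₁ invariant)))) (allFin⁺ n)
      where
      Fopt↭ : N ++ Ls ↭ Fopt
      Fopt↭ = ↭-sym (↭-trans (filter-partition-↭ light? Fopt) (++-comm Ls N))
    counted : length (filter (meets? S) Cs) ℕ.+ nLT Fopt ℕ.≤ k
    counted = ℕ.≤-trans (meeting+light≤meeting S Ls (all-filter light? Fopt) unique)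
                (ℕ.≤-trans (List.length-filter (meets? (S ++ concatMap verts Ls)) Cs) (proj₁ (proj₁ optimal)))

-- The bound does not need ∣ D ∣ ≤ k.
lemma1 : ∀ {n : ℕ} (D : Subset n) (k : ℕ) (w : Fin n → Fin n → ℚ)
         → IsMetric w
         → ∣ D ∣ Data.Nat.≤ k
         → (Cs : List (List (Fin n))) (λ* : ℚ)
         → IsOptimalCover D k w Cs λ*
         → (d⋆ : Fin n → Fin n) → IsArgminChoice D w d⋆
         → (T̂ : List (Maybe (Fin n) × Maybe (Fin n)))
         → MST (ŵ w d⋆) (contractedVerts D) T̂
         → (Ts : List Tree) → IsTreesOf (Fstar d⋆ T̂) Ts
         → (E† : List Edge) → Dagger w Ts E†
         → (Fopt : List Tree) → Types.Elim w Cs λ* E† Ts Fopt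
         → Types.heavyW w Cs λ* Fopt ≤ scaleBy k (Types.nLT w Cs λ* Fopt) λ*
lemma1 D k w metric _ Cs λ* optimal d⋆ argmin T̂ mst Ts trees E† dagger Fopt elim =
  Setting.heavyW≤scaleBy D k w metric Cs λ* optimal d⋆ argmin T̂ mst Ts trees E† dagger elim
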